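{- For every $m \ge 1$, the theta series of the Barnes–Wall lattice $BW_{2^m}$ satisfies $\Theta_{BW_{2^m}}(x) \equiv 1 \pmod{2^{m+1}}$, and hence $\Theta_{BW_{2^m}}(x) \in \mathcal{P}_{2^m}$. Moreover, for every $m \ge 2$, $$\frac{\Theta_{BW_{2^m}}(x) - 1}{2^{m+1}} \equiv (1 - 2^{m-1})\, \frac{\Theta_{BW_{2^{m-1}}}(x^2) - 1}{2^m} \pmod{2^m}.$$
   Context: $R := 1 + x\mathbb{Z}[[x]]$ and $\mathcal{P}_n := \{ g^n \mid g \in R\}$. For a lattice $\Lambda$ with integer norms, $\Theta_\Lambda(x) := \sum_{u \in \Lambda} x^{u \cdot u}$. The Barnes–Wall lattice $BW_{2^m} \subset \mathbb{R}^{2^m}$ is normalized to have minimal norm $2^{m-1}$; concretely, identifying $\mathbb{R}^{2^m}$ with $\mathbb{C}^{2^{m-1}}$ (norm $u\cdot u = \sum |u_j|^2$), $BW_2 = \mathbb{Z}[i] \cong \mathbb{Z}^2$ and $BW_{2^{m+1}} = \{ (u, u + (1+i)v) \mid u, v \in BW_{2^m}\}$. Thus $BW_2 = \mathbb{Z}^2$, $BW_4 \cong D_4$, $BW_8 \cong \sqrt{2}E_8$, $BW_{16} \cong \sqrt{2}\Lambda_{16}$. Congruences of power series mod an integer are coefficientwise. -}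

module Defs where

open import Data.Nat as ℕ using (ℕ; zero; suc)
open import Data.Integer as ℤ using (ℤ; +_; _+_; _-_; _*_; ∣_∣)
open import Data.Fin using (Fin)
open import Data.Product using (Σ; _×_; _,_; ∃)
open import Data.Integer.Divisibility using () renaming (_∣_ to _∣ℤ_)
open import Data.Unit using (⊤)
open import Function.Bundles using (_↔_)
open import Relation.Binary.PropositionalEquality using (_≡_)

record ℤ[i] : Set where
  constructor _+_i
  field
    re : ℤ
    im : ℤ
open ℤ[i] public

_⊕_ : ℤ[i] → ℤ[i] → ℤ[i]
(a + b i) ⊕ (c + d i) = (a + c) + (b + d) i

-- multiplication by (1 + i):  (a + b i)(1 + i) = (a - b) + (a + b) i
mul1+i : ℤ[i] → ℤ[i]
mul1+i (a + b i) = (a - b) + (a + b) i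

gnorm : ℤ[i] → ℕ
gnorm (a + b i) = ∣ a ∣ ℕ.* ∣ a ∣ ℕ.+ ∣ b ∣ ℕ.* ∣ b ∣

-- Vectors in ℂ^{2^k} with Gaussian-integer coordinates, as perfect
-- binary trees of depth k (node u w ≙ the concatenation (u , w)).

data CVec : ℕ → Set where
  leaf : ℤ[i] → CVec zero
  node : ∀ {k} → CVec k → CVec k → CVec (suc k)

_⊕ᵥ_ : ∀ {k} → CVec k → CVec k → CVec k
leaf z ⊕ᵥ leaf w = leaf (z ⊕ w)
node u₁ u₂ ⊕ᵥ node w₁ w₂ = node (u₁ ⊕ᵥ w₁) (u₂ ⊕ᵥ w₂)

mul1+iᵥ : ∀ {k} → CVec k → CVec k
mul1+iᵥ (leaf z) = leaf (mul1+i z)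
mul1+iᵥ (node u w) = node (mul1+iᵥ u) (mul1+iᵥ w)

norm : ∀ {k} → CVec k → ℕ
norm (leaf z) = gnorm z
norm (node u w) = norm u ℕ.+ norm w

-- Barnes–Wall lattices.  BW k is the lattice BW_{2^(k+1)} ⊂ ℂ^{2^k}:
--   BW_2 = ℤ[i],  BW_{2^{m+1}} = {(u , u + (1+i) v) | u, v ∈ BW_{2^m}}.

BW : (k : ℕ) → CVec k → Set
BW zero    _ = ⊤
BW (suc k) w = Σ (CVec k) λ u → Σ (CVec k) λ v →
               BW k u × BW k v × (w ≡ node u (u ⊕ᵥ mul1+iᵥ v))

PowerSeries : Set
PowerSeries = ℕ → ℤ

IsThetaBW : (k : ℕ) → PowerSeries → Set
IsThetaBW k θ = ∀ n → Σ ℕ λ c → (θ n ≡ + c) ×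
  (Fin c ↔ Σ (CVec k) λ u → BW k u × norm u ≡ n)

one : PowerSeries
one zero    = + 1
one (suc _) = + 0

convolve : PowerSeries → PowerSeries → ℕ → ℤ
convolve f g zero    = f 0 * g 0
convolve f g (suc n) = f 0 * g (suc n) + convolve (λ i → f (suc i)) g n

_·_ : PowerSeries → PowerSeries → PowerSeries
(f · g) n = convolve f g n

_^ₚ_ : PowerSeries → ℕ → PowerSeries
f ^ₚ zero    = one
f ^ₚ suc n   = f · (f ^ₚ n)

InR : PowerSeries → Set
InR g = g 0 ≡ + 1

InP : ℕ → PowerSeries → Set
InP n f = Σ PowerSeries λ g → InR g × (∀ i → f i ≡ (g ^ₚ n) i)

sub2 : PowerSeries → PowerSeries
sub2 f zero          = f zero
sub2 f (suc zero)    = + 0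
sub2 f (suc (suc n)) = sub2 (λ i → f (suc i)) n

_≡_[mod_] : PowerSeries → PowerSeries → ℕ → Set
f ≡ g [mod q ] = ∀ n → (+ q) ∣ℤ (f n - g n)

-- Write L = BW_{2^(k+1)} ⊂ ℂ^(2^k).  A group G_k of isometries preserving L
-- (generated at level zero by a ↦ -a, conjugation and a ↦ i·conj a; at the
-- next level by G_k acting diagonally, (x , y) ↦ (x , -y) and (x , y) ↦ (y , x))
-- has all its nonzero orbits of size divisible by 2^(k+2): by induction, a sum
-- over pairs splits into row sums, each even by negating the second entry,
-- plus twice a single column.  Summing over a box of vectors the indicator of
-- "lies in L and has norm n" therefore gives θ_L ≡ 1 mod 2^(k+2).  A series
-- f ≡ 1 mod 2^(j+1) is a 2^j-th power: f = 1 + 4h has the square root 1 + 2u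
-- where u + u² = h, and then u ≡ 0 mod 2^j.
--
-- For the second congruence, BW_{2^(k+2)} = {(x , y) | x ∈ L, y ≡ x mod (1+i)L}.
-- Its vectors with x = 0 or y = 0 contribute 1 + 2 (θ_L(x²) - 1); the others
-- contribute P = Σ_{a+b=n} q(a,b), where q(a,b) counts pairs of nonzero
-- congruent vectors of norms a and b.  With E = 2^(k+2), applying the orbit
-- argument to x and to y gives E² | q(a,b), and q is symmetric, so modulo 2E²
-- P reduces to q(m,m) when n = 2m and to 0 otherwise.  Grouping by classes C
-- modulo (1+i)L, q(m,m) = Σ_C |C|² with E | |C|, hence q(m,m) ≡ E Σ_C |C| =
-- E θ_L(m) modulo 2E².  Altogether θ - 1 - 2 (θ_L(x²) - 1) ≡ E (θ_L(x²) - 1)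
-- modulo 2E², and dividing by 2E gives the stated congruence.

module Submission where

open import Defs

open import Axiom.UniquenessOfIdentityProofs.WithK using (uip)
open import Data.Bool using (if_then_else_)
open import Data.Empty using (⊥; ⊥-elim)
open import Data.Fin as Fin using (Fin)
open import Data.Fin.Permutation using (↔⇒≡)
open import Data.Integer as ℤ using (ℤ; +_; -[1+_]; 0ℤ; 1ℤ; _+_; _-_; _*_; -_; ∣_∣)
open import Data.Integer.DivMod using (_%ℕ_; _/ℕ_; n%ℕd<d; a≡a%ℕn+[a/ℕn]*n)
open import Data.Integer.Divisibility.Signed
  using (_∣_; _∣?_; divides; ∣⇒∣ᵤ; ∣-refl; ∣-trans; ∣m∣n⇒∣m+n; ∣m∣n⇒∣m-n; ∣m⇒∣-m; ∣n⇒∣m*n; ∣m⇒∣m*n;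
         *-monoʳ-∣; *-monoˡ-∣; *-cancelˡ-∣)
import Data.Integer.Properties as ℤₚ
open import Data.Integer.Tactic.RingSolver using (solve-∀)
open import Data.List using (List; []; _∷_; _++_; map; cartesianProductWith; length; filter; lookup; find)
open import Data.List.Membership.Propositional using (_∈_)
open import Data.List.Membership.Propositional.Properties using (∈-lookup; ∈-filter⁺; ∈-filter⁻)
open import Data.List.Membership.Setoid.Properties using (unique⇒irrelevant)
open import Data.List.Relation.Unary.All as All using ([]; _∷_)
open import Data.List.Relation.Unary.AllPairs using ([]; _∷_)
open import Data.List.Relation.Unary.Any as Any using (here; there)
import Data.List.Relation.Unary.Any.Properties as Anyₚ
open import Data.List.Relation.Unary.Unique.Propositional using (Unique)
import Data.List.Relation.Unary.Unique.Propositional.Properties as Unique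
open import Data.Maybe using (just; nothing; fromMaybe)
open import Data.Nat as ℕ using (ℕ; zero; suc; _^_; _≤_; _<_; z≤n; s≤s)
import Data.Nat.Properties as ℕₚ
import Data.Nat.Tactic.RingSolver as ℕ-Solver
open import Data.Product using (Σ; _×_; _,_; proj₁; proj₂)
open import Data.Sum using (_⊎_; inj₁; inj₂)
open import Data.Unit using (⊤; tt)
open import Function using (_∘_)
open import Function.Bundles using (_↔_; mk↔ₛ′)
open import Function.Properties.Inverse using (↔-trans; ↔-sym)
open import Relation.Binary.Definitions using (DecidableEquality)
open import Relation.Binary.PropositionalEquality
open import Relation.Nullary using (Dec; yes; no; does; ¬_)
open import Relation.Nullary.Decidable using (_×-dec_; map′)
open import Relation.Unary using (Decidable; Irrelevant)
open ≡-Reasoning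

private variable k : ℕ

pow2 : ℕ → ℤ
pow2 e = + (2 ^ e)

pow2-suc : ∀ e → pow2 (suc e) ≡ + 2 * pow2 e
pow2-suc e = ℤₚ.pos-* 2 (2 ^ e)

m-n+n≡m : ∀ m n → m - n + n ≡ m
m-n+n≡m = solve-∀

∣0 : ∀ d → d ∣ 0ℤ
∣0 d = divides 0ℤ (sym (ℤₚ.*-zeroˡ d))

1∣ : ∀ a → 1ℤ ∣ a
1∣ a = divides a (sym (ℤₚ.*-identityʳ a))

*-pres-∣ : ∀ {a b c d} → a ∣ b → c ∣ d → a * c ∣ b * d
*-pres-∣ {a} {d = d} a∣b c∣d = ∣-trans (*-monoʳ-∣ a c∣d) (*-monoˡ-∣ d a∣b)

∑ : {A : Set} → List A → (A → ℤ) → ℤ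
∑ []       f = 0ℤ
∑ (x ∷ xs) f = f x + ∑ xs f

syntax ∑ xs (λ x → e) = ∑[ x ← xs ] e

module _ {A : Set} where

  ∑-cong : ∀ (xs : List A) {f g : A → ℤ} → (∀ x → f x ≡ g x) → ∑ xs f ≡ ∑ xs g
  ∑-cong []       f≗g = refl
  ∑-cong (x ∷ xs) f≗g = cong₂ _+_ (f≗g x) (∑-cong xs f≗g)

  ∑-+ : ∀ (xs : List A) (f g : A → ℤ) → ∑[ x ← xs ] (f x + g x) ≡ ∑ xs f + ∑ xs g
  ∑-+ []       f g = refl
  ∑-+ (x ∷ xs) f g = begin
    f x + g x + ∑[ x ← xs ] (f x + g x) ≡⟨ cong (_+_ (f x + g x)) (∑-+ xs f g) ⟩
    f x + g x + (∑ xs f + ∑ xs g)      ≡⟨ interchange (f x) (g x) (∑ xs f) (∑ xs g) ⟩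
    f x + ∑ xs f + (g x + ∑ xs g)      ∎
    where
    interchange : ∀ a b c d → a + b + (c + d) ≡ a + c + (b + d)
    interchange = solve-∀

  ∑-0 : ∀ (xs : List A) → ∑[ x ← xs ] 0ℤ ≡ 0ℤ
  ∑-0 []       = refl
  ∑-0 (x ∷ xs) = trans (ℤₚ.+-identityˡ _) (∑-0 xs)

  ∑-*ˡ : ∀ (xs : List A) c (f : A → ℤ) → ∑[ x ← xs ] (c * f x) ≡ c * ∑ xs f
  ∑-*ˡ []       c f = sym (ℤₚ.*-zeroʳ c)
  ∑-*ˡ (x ∷ xs) c f = trans (cong (_+_ (c * f x)) (∑-*ˡ xs c f)) (sym (ℤₚ.*-distribˡ-+ c (f x) (∑ xs f)))

  ∑-*ʳ : ∀ (xs : List A) (f : A → ℤ) c → ∑[ x ← xs ] (f x * c) ≡ ∑ xs f * c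
  ∑-*ʳ xs f c = begin
    ∑[ x ← xs ] (f x * c) ≡⟨ ∑-cong xs (λ x → ℤₚ.*-comm (f x) c) ⟩
    ∑[ x ← xs ] (c * f x) ≡⟨ ∑-*ˡ xs c f ⟩
    c * ∑ xs f            ≡⟨ ℤₚ.*-comm c (∑ xs f) ⟩
    ∑ xs f * c            ∎

  ∑-neg : ∀ (xs : List A) (f : A → ℤ) → ∑[ x ← xs ] (- f x) ≡ - ∑ xs f
  ∑-neg xs f = begin
    ∑[ x ← xs ] (- f x)      ≡⟨ ∑-cong xs (λ x → ℤₚ.-1*i≡-i (f x)) ⟨
    ∑[ x ← xs ] (- 1ℤ * f x) ≡⟨ ∑-*ˡ xs (- 1ℤ) f ⟩
    - 1ℤ * ∑ xs f            ≡⟨ ℤₚ.-1*i≡-i (∑ xs f) ⟩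
    - ∑ xs f                 ∎

  ∑-sub : ∀ (xs : List A) (f g : A → ℤ) → ∑[ x ← xs ] (f x - g x) ≡ ∑ xs f - ∑ xs g
  ∑-sub xs f g = trans (∑-+ xs f (λ x → - g x)) (cong (_+_ (∑ xs f)) (∑-neg xs g))

  ∑-cong-∈ : ∀ (xs : List A) {f g : A → ℤ} → (∀ {x} → x ∈ xs → f x ≡ g x) → ∑ xs f ≡ ∑ xs g
  ∑-cong-∈ []       f≗g = refl
  ∑-cong-∈ (x ∷ xs) f≗g = cong₂ _+_ (f≗g (here refl)) (∑-cong-∈ xs (f≗g ∘ there))

  ∑-∣ : ∀ (xs : List A) {d} {f : A → ℤ} → (∀ x → d ∣ f x) → d ∣ ∑ xs f
  ∑-∣ []       {d} d∣f = ∣0 d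
  ∑-∣ (x ∷ xs)     d∣f = ∣m∣n⇒∣m+n (d∣f x) (∑-∣ xs d∣f)

  ∑-++ : ∀ (xs ys : List A) (f : A → ℤ) → ∑ (xs ++ ys) f ≡ ∑ xs f + ∑ ys f
  ∑-++ []       ys f = sym (ℤₚ.+-identityˡ _)
  ∑-++ (x ∷ xs) ys f = trans (cong (_+_ (f x)) (∑-++ xs ys f)) (sym (ℤₚ.+-assoc (f x) (∑ xs f) (∑ ys f)))

module _ {A B : Set} where

  ∑-comm : ∀ (xs : List A) (ys : List B) (f : A → B → ℤ) →
           ∑[ x ← xs ] ∑[ y ← ys ] f x y ≡ ∑[ y ← ys ] ∑[ x ← xs ] f x y
  ∑-comm []       ys f = sym (∑-0 ys)
  ∑-comm (x ∷ xs) ys f = begin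
    ∑ ys (f x) + ∑[ x ← xs ] ∑[ y ← ys ] f x y ≡⟨ cong (_+_ (∑ ys (f x))) (∑-comm xs ys f) ⟩
    ∑ ys (f x) + ∑[ y ← ys ] ∑[ x ← xs ] f x y ≡⟨ ∑-+ ys (f x) (λ y → ∑[ x ← xs ] f x y) ⟨
    ∑[ y ← ys ] (f x y + ∑[ x ← xs ] f x y)    ∎

  ∑-map : ∀ (g : A → B) (xs : List A) (f : B → ℤ) → ∑ (map g xs) f ≡ ∑[ x ← xs ] f (g x)
  ∑-map g []       f = refl
  ∑-map g (x ∷ xs) f = cong (_+_ (f (g x))) (∑-map g xs f)

∑-cartesianProductWith : ∀ {A B : Set} (g : A → A → B) (xs ys : List A) (f : B → ℤ) →
  ∑ (cartesianProductWith g xs ys) f ≡ ∑[ x ← xs ] ∑[ y ← ys ] f (g x y)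
∑-cartesianProductWith g []       ys f = refl
∑-cartesianProductWith g (x ∷ xs) ys f = begin
  ∑ (map (g x) ys ++ cartesianProductWith g xs ys) f                 ≡⟨ ∑-++ (map (g x) ys) _ f ⟩
  ∑ (map (g x) ys) f + ∑ (cartesianProductWith g xs ys) f            ≡⟨ cong₂ _+_ (∑-map (g x) ys f) (∑-cartesianProductWith g xs ys f) ⟩
  ∑[ y ← ys ] f (g x y) + ∑[ x ← xs ] ∑[ y ← ys ] f (g x y)          ∎

∈-cartesianProductWith : ∀ {A B C : Set} (f : A → B → C) {xs ys x y} →
  x ∈ xs → y ∈ ys → f x y ∈ cartesianProductWith f xs ys
∈-cartesianProductWith f = Anyₚ.cartesianProductWith⁺ f (cong₂ f)

𝟙 : {P : Set} → Dec P → ℤ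
𝟙 p = if does p then 1ℤ else 0ℤ

𝟙-cong : {P Q : Set} → (P → Q) → (Q → P) → (p : Dec P) (q : Dec Q) → 𝟙 p ≡ 𝟙 q
𝟙-cong P⇒Q Q⇒P (yes p) (yes q) = refl
𝟙-cong P⇒Q Q⇒P (yes p) (no ¬q) = ⊥-elim (¬q (P⇒Q p))
𝟙-cong P⇒Q Q⇒P (no ¬p) (yes q) = ⊥-elim (¬p (Q⇒P q))
𝟙-cong P⇒Q Q⇒P (no ¬p) (no ¬q) = refl

𝟙-× : {P Q : Set} (p : Dec P) (q : Dec Q) → 𝟙 (p ×-dec q) ≡ 𝟙 p * 𝟙 q
𝟙-× (yes _) (yes _) = refl
𝟙-× (yes _) (no _)  = refl
𝟙-× (no _)  _       = refl

module _ {A : Set} {P : A → Set} (P? : Decidable P) where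

  ∑-𝟙 : ∀ xs → ∑[ x ← xs ] 𝟙 (P? x) ≡ + length (filter P? xs)
  ∑-𝟙 []       = refl
  ∑-𝟙 (x ∷ xs) with P? x
  ... | yes _ = trans (cong (_+_ 1ℤ) (∑-𝟙 xs)) (sym (ℤₚ.pos-+ 1 (length (filter P? xs))))
  ... | no  _ = trans (ℤₚ.+-identityˡ _) (∑-𝟙 xs)

Fin-length↔∈ : ∀ {A : Set} {xs : List A} → Unique xs → Fin (length xs) ↔ Σ A (_∈ xs)
Fin-length↔∈ {A} {xs} xs! = mk↔ₛ′ to (λ a∈ → Any.index (proj₂ a∈)) to-index index-to
  where
  to : Fin (length xs) → Σ A (_∈ xs)
  to j = lookup xs j , ∈-lookup j
  to-index : ∀ a∈ → to (Any.index (proj₂ a∈)) ≡ a∈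
  to-index (a , a∈) with lookup xs (Any.index a∈) | Anyₚ.lookup-index a∈ | ∈-lookup {xs = xs} (Any.index a∈)
  ... | _ | refl | b∈ = cong (a ,_) (unique⇒irrelevant (setoid A) uip xs! b∈ a∈)
  index-to : ∀ {ys : List A} j → Any.index (∈-lookup {xs = ys} j) ≡ j
  index-to {_ ∷ _}  Fin.zero    = refl
  index-to {_ ∷ ys} (Fin.suc j) = cong Fin.suc (index-to {ys} j)

Σ-↔-irrelevant : ∀ {A : Set} {P Q : A → Set} → Irrelevant P → Irrelevant Q →
                 (∀ {a} → P a → Q a) → (∀ {a} → Q a → P a) → Σ A P ↔ Σ A Q
Σ-↔-irrelevant P-irr Q-irr P⇒Q Q⇒P =
  mk↔ₛ′ (λ (a , p) → a , P⇒Q p) (λ (a , q) → a , Q⇒P q)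
        (λ (a , q) → cong (a ,_) (Q-irr _ q)) (λ (a , p) → cong (a ,_) (P-irr _ p))

Fin-count↔ : ∀ {A : Set} {P : A → Set} (P? : Decidable P) → Irrelevant P →
             ∀ {xs} → Unique xs → (∀ {a} → P a → a ∈ xs) → Fin (length (filter P? xs)) ↔ Σ A P
Fin-count↔ P? P-irr {xs} xs! complete = ↔-trans (Fin-length↔∈ ys!)
  (Σ-↔-irrelevant (unique⇒irrelevant (setoid _) uip ys!) P-irr
                  (λ a∈ → proj₂ (∈-filter⁻ P? {xs = xs} a∈)) (λ p → ∈-filter⁺ P? (complete p) p))
  where ys! : Unique (filter P? xs)
        ys! = Unique.filter⁺ P? {xs} xs!

module _ {A : Set} {P : A → Set} (P? : Decidable P) where

  find-just : ∀ {xs r} → find P? xs ≡ just r → r ∈ xs × P r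
  find-just {x ∷ xs} eq with P? x
  find-just {x ∷ xs} refl | yes px = here refl , px
  ... | no _ = let r∈ , pr = find-just {xs} eq in there r∈ , pr

  find-found : ∀ {xs x} → x ∈ xs → P x → Σ A λ r → find P? xs ≡ just r
  find-found {y ∷ xs} x∈ px with P? y
  ... | yes _ = y , refl
  find-found {y ∷ xs} (here refl) px | no ¬py = ⊥-elim (¬py px)
  find-found {y ∷ xs} (there x∈) px | no _ = find-found x∈ px

find-cong : ∀ {A : Set} {P Q : A → Set} (P? : Decidable P) (Q? : Decidable Q) →
            (∀ {a} → P a → Q a) → (∀ {a} → Q a → P a) → ∀ xs → find P? xs ≡ find Q? xs
find-cong P? Q? P⇒Q Q⇒P []       = refl
find-cong P? Q? P⇒Q Q⇒P (x ∷ xs) with P? x | Q? x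
... | yes _  | yes _  = refl
... | yes px | no ¬qx = ⊥-elim (¬qx (P⇒Q px))
... | no ¬px | yes qx = ⊥-elim (¬px (Q⇒P qx))
... | no _   | no _   = find-cong P? Q? P⇒Q Q⇒P xs

module _ {A : Set} (_≟_ : DecidableEquality A) where

  ∑-𝟙-≟-absent : ∀ {xs} t → All.All (t ≢_) xs → ∑[ r ← xs ] 𝟙 (r ≟ t) ≡ 0ℤ
  ∑-𝟙-≟-absent         t []           = refl
  ∑-𝟙-≟-absent {r ∷ _} t (t≢r ∷ t∉) with r ≟ t
  ... | yes refl = ⊥-elim (t≢r refl)
  ... | no _     = trans (ℤₚ.+-identityˡ _) (∑-𝟙-≟-absent t t∉)

  ∑-𝟙-≟ : ∀ {xs} t → t ∈ xs → Unique xs → ∑[ r ← xs ] 𝟙 (r ≟ t) ≡ 1ℤ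
  ∑-𝟙-≟ {r ∷ _} t t∈ (r∉ ∷ xs!) with r ≟ t | t∈
  ... | yes refl | _         = trans (cong (_+_ 1ℤ) (∑-𝟙-≟-absent r r∉)) refl
  ... | no r≢t   | here t≡r  = ⊥-elim (r≢t (sym t≡r))
  ... | no _     | there t∈′ = trans (ℤₚ.+-identityˡ _) (∑-𝟙-≟ t t∈′ xs!)

module ClassRepresentatives {A : Set} {R : A → A → Set} (R? : ∀ x y → Dec (R x y))
  (R-sym : ∀ {x y} → R x y → R y x) (R-trans : ∀ {x y z} → R x y → R y z → R x z)
  (_≟_ : DecidableEquality A) (xs : List A) (xs! : Unique xs) where

  rep : A → A
  rep y = fromMaybe y (find (λ r → R? r y) xs)

  rep-∈ : ∀ {y} → y ∈ xs → rep y ∈ xs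
  rep-∈ {y} y∈ with find (λ r → R? r y) xs in eq
  ... | just r  = proj₁ (find-just (λ r → R? r y) {xs} eq)
  ... | nothing = y∈

  rep-R : ∀ {y} → R y y → R (rep y) y
  rep-R {y} Ryy with find (λ r → R? r y) xs in eq
  ... | just r  = proj₂ (find-just (λ r → R? r y) {xs} eq)
  ... | nothing = Ryy

  rep-resp : ∀ {r y} → y ∈ xs → R r y → rep y ≡ rep r
  rep-resp {r} {y} y∈ Rry with find-found (λ a → R? a r) {xs} y∈ (R-sym Rry)
  ... | t , found = trans (cong (fromMaybe y) (trans same-search found)) (cong (fromMaybe r) (sym found))
    where
    same-search : find (λ a → R? a y) xs ≡ find (λ a → R? a r) xs
    same-search = find-cong (λ a → R? a y) (λ a → R? a r)
                            (λ Ray → R-trans Ray (R-sym Rry)) (λ Rar → R-trans Rar Rry) xs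

  𝟙-≟-rep : ∀ r {y} → y ∈ xs → R y y → 𝟙 (r ≟ rep y) ≡ 𝟙 (rep r ≟ r) * 𝟙 (R? r y)
  𝟙-≟-rep r {y} y∈ Ryy = trans (𝟙-cong to from (r ≟ rep y) (rep r ≟ r ×-dec R? r y)) (𝟙-× (rep r ≟ r) (R? r y))
    where
    to : r ≡ rep y → rep r ≡ r × R r y
    to refl = sym (rep-resp y∈ (rep-R Ryy)) , rep-R Ryy
    from : rep r ≡ r × R r y → r ≡ rep y
    from (rep-r≡r , Rry) = trans (sym rep-r≡r) (sym (rep-resp y∈ Rry))

  ∑-by-classes : (Φ : A → ℤ) → (∀ y → ¬ R y y → Φ y ≡ 0ℤ) →
                 ∑ xs Φ ≡ ∑[ r ← xs ] (𝟙 (rep r ≟ r) * ∑[ y ← xs ] (𝟙 (R? r y) * Φ y))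
  ∑-by-classes Φ Φ-support = begin
    ∑ xs Φ                                                         ≡⟨ ∑-cong-∈ xs (λ y∈ → sym (counted-once y∈)) ⟩
    ∑[ y ← xs ] (∑[ r ← xs ] 𝟙 (r ≟ rep y) * Φ y)                  ≡⟨ ∑-cong xs (λ y → ∑-*ʳ xs (λ r → 𝟙 (r ≟ rep y)) (Φ y)) ⟨
    ∑[ y ← xs ] ∑[ r ← xs ] (𝟙 (r ≟ rep y) * Φ y)                  ≡⟨ ∑-comm xs xs _ ⟩
    ∑[ r ← xs ] ∑[ y ← xs ] (𝟙 (r ≟ rep y) * Φ y)                  ≡⟨ ∑-cong xs (λ r → ∑-cong-∈ xs (by-class r)) ⟩
    ∑[ r ← xs ] ∑[ y ← xs ] (𝟙 (rep r ≟ r) * (𝟙 (R? r y) * Φ y))   ≡⟨ ∑-cong xs (λ r → ∑-*ˡ xs (𝟙 (rep r ≟ r)) _) ⟩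
    ∑[ r ← xs ] (𝟙 (rep r ≟ r) * ∑[ y ← xs ] (𝟙 (R? r y) * Φ y))   ∎
    where
    counted-once : ∀ {y} → y ∈ xs → ∑[ r ← xs ] 𝟙 (r ≟ rep y) * Φ y ≡ Φ y
    counted-once {y} y∈ = trans (cong (_* Φ y) (∑-𝟙-≟ _≟_ (rep y) (rep-∈ y∈) xs!)) (ℤₚ.*-identityˡ (Φ y))
    by-class : ∀ r {y} → y ∈ xs → 𝟙 (r ≟ rep y) * Φ y ≡ 𝟙 (rep r ≟ r) * (𝟙 (R? r y) * Φ y)
    by-class r {y} y∈ with R? y y
    ... | yes Ryy = trans (cong (_* Φ y) (𝟙-≟-rep r y∈ Ryy)) (ℤₚ.*-assoc (𝟙 (rep r ≟ r)) _ (Φ y))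
    ... | no ¬Ryy rewrite Φ-support y ¬Ryy = trans (ℤₚ.*-zeroʳ (𝟙 (r ≟ rep y)))
      (sym (trans (cong (𝟙 (rep r ≟ r) *_) (ℤₚ.*-zeroʳ (𝟙 (R? r y)))) (ℤₚ.*-zeroʳ (𝟙 (rep r ≟ r)))))

-- Power series: 2^j-th roots of series ≡ 1 modulo 2^(j+1)

shift : PowerSeries → PowerSeries
shift f n = f (suc n)

·-cong : ∀ {f f′ g g′ : PowerSeries} → (∀ n → f n ≡ f′ n) → (∀ n → g n ≡ g′ n) →
         ∀ n → (f · g) n ≡ (f′ · g′) n
·-cong f≗f′ g≗g′ zero    = cong₂ _*_ (f≗f′ 0) (g≗g′ 0)
·-cong f≗f′ g≗g′ (suc n) = cong₂ _+_ (cong₂ _*_ (f≗f′ 0) (g≗g′ (suc n))) (·-cong (λ m → f≗f′ (suc m)) g≗g′ n)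

·-distribʳ-+ : ∀ (f f′ g : PowerSeries) n → ((λ m → f m + f′ m) · g) n ≡ (f · g) n + (f′ · g) n
·-distribʳ-+ f f′ g zero    = ℤₚ.*-distribʳ-+ (g 0) (f 0) (f′ 0)
·-distribʳ-+ f f′ g (suc n) =
  trans (cong₂ _+_ (ℤₚ.*-distribʳ-+ (g (suc n)) (f 0) (f′ 0)) (·-distribʳ-+ (shift f) (shift f′) g n))
        (interchange (f 0 * g (suc n)) (f′ 0 * g (suc n)) ((shift f · g) n) ((shift f′ · g) n))
  where interchange : ∀ a b c d → a + b + (c + d) ≡ a + c + (b + d)
        interchange = solve-∀

·-distribˡ-+ : ∀ (f g g′ : PowerSeries) n → (f · (λ m → g m + g′ m)) n ≡ (f · g) n + (f · g′) n
·-distribˡ-+ f g g′ zero    = ℤₚ.*-distribˡ-+ (f 0) (g 0) (g′ 0)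
·-distribˡ-+ f g g′ (suc n) =
  trans (cong₂ _+_ (ℤₚ.*-distribˡ-+ (f 0) (g (suc n)) (g′ (suc n))) (·-distribˡ-+ (shift f) g g′ n))
        (interchange (f 0 * g (suc n)) (f 0 * g′ (suc n)) ((shift f · g) n) ((shift f · g′) n))
  where interchange : ∀ a b c d → a + b + (c + d) ≡ a + c + (b + d)
        interchange = solve-∀

·-scaleˡ : ∀ c (f g : PowerSeries) n → ((λ m → c * f m) · g) n ≡ c * (f · g) n
·-scaleˡ c f g zero    = ℤₚ.*-assoc c (f 0) (g 0)
·-scaleˡ c f g (suc n) = trans (cong (_+_ (c * f 0 * g (suc n))) (·-scaleˡ c (shift f) g n)) (lemma c (f 0) (g (suc n)) _)
  where lemma : ∀ c a b x → c * a * b + c * x ≡ c * (a * b + x)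
        lemma = solve-∀

·-scaleʳ : ∀ c (f g : PowerSeries) n → (f · (λ m → c * g m)) n ≡ c * (f · g) n
·-scaleʳ c f g zero    = lemma c (f 0) (g 0)
  where lemma : ∀ c a b → a * (c * b) ≡ c * (a * b)
        lemma = solve-∀
·-scaleʳ c f g (suc n) = trans (cong (_+_ (f 0 * (c * g (suc n)))) (·-scaleʳ c (shift f) g n)) (lemma c (f 0) (g (suc n)) _)
  where lemma : ∀ c a b x → a * (c * b) + c * x ≡ c * (a * b + x)
        lemma = solve-∀

·-zeroˡ : ∀ (g : PowerSeries) n → ((λ _ → 0ℤ) · g) n ≡ 0ℤ
·-zeroˡ g zero    = refl
·-zeroˡ g (suc n) = trans (ℤₚ.+-identityˡ _) (·-zeroˡ g n)

·-identityˡ : ∀ (g : PowerSeries) n → (one · g) n ≡ g n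
·-identityˡ g zero    = ℤₚ.*-identityˡ (g 0)
·-identityˡ g (suc n) = trans (cong₂ _+_ (ℤₚ.*-identityˡ (g (suc n))) (·-zeroˡ g n)) (ℤₚ.+-identityʳ _)

·-identityʳ : ∀ (f : PowerSeries) n → (f · one) n ≡ f n
·-identityʳ f zero    = ℤₚ.*-identityʳ (f 0)
·-identityʳ f (suc n) = trans (cong₂ _+_ (ℤₚ.*-zeroʳ (f 0)) (·-identityʳ (shift f) n)) (ℤₚ.+-identityˡ _)

·-assoc : ∀ (f g h : PowerSeries) n → ((f · g) · h) n ≡ (f · (g · h)) n
·-assoc f g h zero    = ℤₚ.*-assoc (f 0) (g 0) (h 0)
·-assoc f g h (suc n) = trans
  (cong (_+_ (f 0 * g 0 * h (suc n)))
    (trans (·-distribʳ-+ (λ m → f 0 * g (suc m)) (shift f · g) h n)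
           (cong₂ _+_ (·-scaleˡ (f 0) (shift g) h n) (·-assoc (shift f) g h n))))
  (lemma (f 0) (g 0) (h (suc n)) ((shift g · h) n) ((shift f · (g · h)) n))
  where lemma : ∀ a b c x y → a * b * c + (a * x + y) ≡ a * (b * c + x) + y
        lemma = solve-∀

^ₚ-+ : ∀ (g : PowerSeries) a b n → (g ^ₚ (a ℕ.+ b)) n ≡ ((g ^ₚ a) · (g ^ₚ b)) n
^ₚ-+ g zero    b n = sym (·-identityˡ (g ^ₚ b) n)
^ₚ-+ g (suc a) b n = trans (·-cong (λ _ → refl) (^ₚ-+ g a b) n) (sym (·-assoc g (g ^ₚ a) (g ^ₚ b) n))

∣-· : ∀ d (f g : PowerSeries) → (∀ n → d ∣ f n) → ∀ n → d ∣ (f · g) n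
∣-· d f g d∣f zero    = ∣m⇒∣m*n (g 0) (d∣f 0)
∣-· d f g d∣f (suc n) = ∣m∣n⇒∣m+n (∣m⇒∣m*n (g (suc n)) (d∣f 0)) (∣-· d (shift f) g (λ m → d∣f (suc m)) n)

·-coeff-cong : ∀ n (a b c d : PowerSeries) → c 0 ≡ 0ℤ → d 0 ≡ 0ℤ →
               (∀ j → j < n → a j ≡ b j) → (∀ j → j ≤ n → c j ≡ d j) → (a · c) n ≡ (b · d) n
·-coeff-cong zero    a b c d c0 d0 _ _ rewrite c0 | d0 = trans (ℤₚ.*-zeroʳ (a 0)) (sym (ℤₚ.*-zeroʳ (b 0)))
·-coeff-cong (suc n) a b c d c0 d0 a≗b c≗d = cong₂ _+_ (cong₂ _*_ (a≗b 0 (s≤s z≤n)) (c≗d (suc n) ℕₚ.≤-refl))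
  (·-coeff-cong n (shift a) (shift b) c d c0 d0 (λ j j<n → a≗b (suc j) (s≤s j<n)) (λ j j≤n → c≗d j (ℕₚ.m≤n⇒m≤1+n j≤n)))

²-coeff-cong : ∀ n (a b : PowerSeries) → a 0 ≡ 0ℤ → b 0 ≡ 0ℤ → (∀ j → j < n → a j ≡ b j) → (a · a) n ≡ (b · b) n
²-coeff-cong zero    a b a0 b0 _ rewrite a0 | b0 = refl
²-coeff-cong (suc n) a b a0 b0 a≗b rewrite a0 | b0 =
  cong (_+_ 0ℤ) (·-coeff-cong n (shift a) (shift b) a b a0 b0 (λ j j<n → a≗b (suc j) (s≤s j<n)) (λ j j≤n → a≗b j (s≤s j≤n)))

record Solution-u+u²≡ (h : PowerSeries) : Set where
  field
    u      : PowerSeries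
    u-0    : u 0 ≡ 0ℤ
    u+u²≡h : ∀ n → u n + (u · u) n ≡ h n
    d∣u    : ∀ d → (∀ n → d ∣ h n) → ∀ n → d ∣ u n

-- Iterate u ↦ h - u · u from 0; the m-th iterate is already correct below m + 1.
solve-u+u²≡h : ∀ (h : PowerSeries) → h 0 ≡ 0ℤ → Solution-u+u²≡ h
solve-u+u²≡h h h0 = record { u = u ; u-0 = refl ; u+u²≡h = u+u²≡h ; d∣u = d∣u }
  where
  iterate : ℕ → PowerSeries
  iterate zero    _ = 0ℤ
  iterate (suc m) n = h n - (iterate m · iterate m) n

  u : PowerSeries
  u n = iterate n n

  iterate-0 : ∀ m → iterate m 0 ≡ 0ℤ
  iterate-0 zero    = refl
  iterate-0 (suc m) = cong₂ (λ a b → a - b * b) h0 (iterate-0 m)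

  iterate-stable : ∀ m n → n ≤ m → iterate (suc m) n ≡ iterate m n
  iterate-stable zero    zero z≤n = iterate-0 1
  iterate-stable (suc m) n  n≤m = cong (_-_ (h n))
    (²-coeff-cong n (iterate (suc m)) (iterate m) (iterate-0 (suc m)) (iterate-0 m)
                  (λ j j<n → iterate-stable m j (ℕₚ.≤-pred (ℕₚ.≤-trans j<n n≤m))))

  iterate≡u : ∀ m n → n ≤ m → iterate m n ≡ u n
  iterate≡u m n n≤m = trans (cong (λ t → iterate t n) (sym (ℕₚ.m∸n+n≡m n≤m))) (go (m ℕ.∸ n))
    where
    go : ∀ d → iterate (d ℕ.+ n) n ≡ u n
    go zero    = refl
    go (suc d) = trans (iterate-stable (d ℕ.+ n) n (ℕₚ.m≤n+m n d)) (go d)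

  u+u²≡h : ∀ n → u n + (u · u) n ≡ h n
  u+u²≡h zero    = sym h0
  u+u²≡h (suc m) = trans
    (cong (_+_ (h (suc m) - (iterate m · iterate m) (suc m)))
          (²-coeff-cong (suc m) u (iterate m) refl (iterate-0 m) (λ j j<1+m → sym (iterate≡u m j (ℕₚ.≤-pred j<1+m)))))
    (m-n+n≡m (h (suc m)) _)

  d∣iterate : ∀ d → (∀ n → d ∣ h n) → ∀ m n → d ∣ iterate m n
  d∣iterate d d∣h zero    n = ∣0 d
  d∣iterate d d∣h (suc m) n = ∣m∣n⇒∣m-n (d∣h n) (∣-· d (iterate m) (iterate m) (d∣iterate d d∣h m) n)

  d∣u : ∀ d → (∀ n → d ∣ h n) → ∀ n → d ∣ u n
  d∣u d d∣h n = d∣iterate d d∣h n n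

^ₚ-double : ∀ (g : PowerSeries) N n → (g ^ₚ (2 ℕ.* N)) n ≡ ((g ^ₚ N) · (g ^ₚ N)) n
^ₚ-double g N n = trans (^ₚ-+ g N (N ℕ.+ 0) n) (·-cong (λ _ → refl) (λ m → cong (λ t → (g ^ₚ t) m) (ℕₚ.+-identityʳ N)) n)

square-root : ∀ j (f : PowerSeries) → f 0 ≡ 1ℤ → (∀ n → pow2 (suc (suc j)) ∣ f n - one n) →
              Σ PowerSeries λ s → s 0 ≡ 1ℤ × (∀ n → pow2 (suc j) ∣ s n - one n) × (∀ n → (s · s) n ≡ f n)
square-root j f f0 2^[j+2]∣f-1 = s , cong (λ t → 1ℤ + + 2 * t) u-0 , 2^[j+1]∣s-1 , s²≡f
  where
  h : PowerSeries
  h zero    = 0ℤ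
  h (suc n) = _∣_.quotient (2^[j+2]∣f-1 (suc n)) * pow2 j

  f≡1+4h : ∀ n → f n ≡ one n + + 4 * h n
  f≡1+4h zero    = f0
  f≡1+4h (suc n) = begin
    f (suc n)                    ≡⟨ ℤₚ.+-identityʳ (f (suc n)) ⟨
    f (suc n) - 0ℤ               ≡⟨ _∣_.equality (2^[j+2]∣f-1 (suc n)) ⟩
    q * pow2 (suc (suc j))       ≡⟨ cong (q *_) (trans (pow2-suc (suc j)) (cong (+ 2 *_) (pow2-suc j))) ⟩
    q * (+ 2 * (+ 2 * pow2 j))   ≡⟨ lemma q (pow2 j) ⟩
    0ℤ + + 4 * (q * pow2 j)      ∎
    where q = _∣_.quotient (2^[j+2]∣f-1 (suc n))
          lemma : ∀ q p → q * (+ 2 * (+ 2 * p)) ≡ 0ℤ + + 4 * (q * p)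
          lemma = solve-∀

  2^j∣h : ∀ n → pow2 j ∣ h n
  2^j∣h zero    = ∣0 (pow2 j)
  2^j∣h (suc n) = divides (_∣_.quotient (2^[j+2]∣f-1 (suc n))) refl

  open Solution-u+u²≡ (solve-u+u²≡h h refl)

  s : PowerSeries
  s n = one n + + 2 * u n

  2^[j+1]∣s-1 : ∀ n → pow2 (suc j) ∣ s n - one n
  2^[j+1]∣s-1 n = subst₂ _∣_ (sym (pow2-suc j)) (sym (lemma (one n) (u n))) (*-monoʳ-∣ (+ 2) (d∣u (pow2 j) 2^j∣h n))
    where lemma : ∀ o a → o + + 2 * a - o ≡ + 2 * a
          lemma = solve-∀

  s²≡f : ∀ n → (s · s) n ≡ f n
  s²≡f n = begin
    (s · s) n                                       ≡⟨ ·-distribʳ-+ one (λ m → + 2 * u m) s n ⟩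
    (one · s) n + ((λ m → + 2 * u m) · s) n         ≡⟨ cong₂ _+_ (·-identityˡ s n) (·-scaleˡ (+ 2) u s n) ⟩
    s n + + 2 * (u · s) n                           ≡⟨ cong (λ t → s n + + 2 * t) (·-distribˡ-+ u one (λ m → + 2 * u m) n) ⟩
    s n + + 2 * ((u · one) n + (u · (λ m → + 2 * u m)) n)
                                                    ≡⟨ cong (λ t → s n + + 2 * t) (cong₂ _+_ (·-identityʳ u n) (·-scaleʳ (+ 2) u u n)) ⟩
    s n + + 2 * (u n + + 2 * (u · u) n)             ≡⟨ lemma (one n) (u n) ((u · u) n) ⟩
    one n + + 4 * (u n + (u · u) n)                 ≡⟨ cong (λ t → one n + + 4 * t) (u+u²≡h n) ⟩
    one n + + 4 * h n                               ≡⟨ f≡1+4h n ⟨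
    f n                                             ∎
    where lemma : ∀ o a c → o + + 2 * a + + 2 * (a + + 2 * c) ≡ o + + 4 * (a + c)
          lemma = solve-∀

2^j-th-root : ∀ j (f : PowerSeries) → f 0 ≡ 1ℤ → (∀ n → pow2 (suc j) ∣ f n - one n) → InP (2 ^ j) f
2^j-th-root zero    f f0 _ = f , f0 , λ n → sym (·-identityʳ f n)
2^j-th-root (suc j) f f0 2^[j+2]∣f-1 with square-root j f f0 2^[j+2]∣f-1
... | s , s0 , 2^[j+1]∣s-1 , s²≡f with 2^j-th-root j s s0 2^[j+1]∣s-1
...   | g , g0 , s≡g^N = g , g0 , λ n → begin
  f n                                 ≡⟨ s²≡f n ⟨
  (s · s) n                           ≡⟨ ·-cong s≡g^N s≡g^N n ⟩
  ((g ^ₚ (2 ^ j)) · (g ^ₚ (2 ^ j))) n ≡⟨ ^ₚ-double g (2 ^ j) n ⟨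
  (g ^ₚ (2 ^ suc j)) n                ∎

∑antidiag : (ℕ → ℕ → ℤ) → ℕ → ℤ
∑antidiag q zero    = q 0 0
∑antidiag q (suc n) = q 0 (suc n) + ∑antidiag (λ a b → q (suc a) b) n

middle : (ℕ → ℕ → ℤ) → ℕ → ℤ
middle q zero          = q 0 0
middle q (suc zero)    = 0ℤ
middle q (suc (suc n)) = middle (λ a b → q (suc a) (suc b)) n

∑antidiag-peel : ∀ (q : ℕ → ℕ → ℤ) n → ∑antidiag q (suc n) ≡ q (suc n) 0 + ∑antidiag (λ a b → q a (suc b)) n
∑antidiag-peel q zero    = ℤₚ.+-comm (q 0 1) (q 1 0)
∑antidiag-peel q (suc n) = trans (cong (_+_ (q 0 (suc (suc n)))) (∑antidiag-peel (λ a b → q (suc a) b) n))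
  (swap (q 0 (suc (suc n))) (q (suc (suc n)) 0) (∑antidiag (λ a b → q (suc a) (suc b)) n))
  where swap : ∀ a b c → a + (b + c) ≡ b + (a + c)
        swap = solve-∀

-- Off-middle terms pair up: q a b + q b a = 2 q a b.
∑antidiag-symmetric : ∀ n (q : ℕ → ℕ → ℤ) D → (∀ a b → q a b ≡ q b a) → (∀ a b → D ∣ q a b) →
                      + 2 * D ∣ ∑antidiag q n - middle q n
∑antidiag-symmetric zero          q D _ _ = subst (_ ∣_) (sym (ℤₚ.+-inverseʳ (q 0 0))) (∣0 _)
∑antidiag-symmetric (suc zero)    q D q-sym D∣q =
  subst (_ ∣_) (sym (trans (cong (λ t → q 0 1 + t - 0ℤ) (q-sym 1 0)) (lemma (q 0 1)))) (*-monoʳ-∣ (+ 2) (D∣q 0 1))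
  where lemma : ∀ a → a + a - 0ℤ ≡ + 2 * a
        lemma = solve-∀
∑antidiag-symmetric (suc (suc n)) q D q-sym D∣q =
  subst (_ ∣_) (sym split) (∣m∣n⇒∣m+n (*-monoʳ-∣ (+ 2) (D∣q 0 (suc (suc n))))
    (∑antidiag-symmetric n inner D (λ a b → q-sym (suc a) (suc b)) (λ a b → D∣q (suc a) (suc b))))
  where
  inner : ℕ → ℕ → ℤ
  inner a b = q (suc a) (suc b)
  lemma : ∀ a c d → a + (a + c) - d ≡ + 2 * a + (c - d)
  lemma = solve-∀
  split : ∑antidiag q (suc (suc n)) - middle q (suc (suc n)) ≡ + 2 * q 0 (suc (suc n)) + (∑antidiag inner n - middle inner n)
  split = begin
    q 0 (suc (suc n)) + ∑antidiag (λ a b → q (suc a) b) (suc n) - middle inner n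
      ≡⟨ cong (λ t → q 0 (suc (suc n)) + t - middle inner n) (∑antidiag-peel (λ a b → q (suc a) b) n) ⟩
    q 0 (suc (suc n)) + (q (suc (suc n)) 0 + ∑antidiag inner n) - middle inner n
      ≡⟨ cong (λ t → q 0 (suc (suc n)) + (t + ∑antidiag inner n) - middle inner n) (q-sym (suc (suc n)) 0) ⟩
    q 0 (suc (suc n)) + (q 0 (suc (suc n)) + ∑antidiag inner n) - middle inner n
      ≡⟨ lemma (q 0 (suc (suc n))) (∑antidiag inner n) (middle inner n) ⟩
    + 2 * q 0 (suc (suc n)) + (∑antidiag inner n - middle inner n) ∎

middle-even : ∀ (q : ℕ → ℕ → ℤ) m → middle q (m ℕ.+ m) ≡ q m m
middle-even q zero    = refl
middle-even q (suc m) rewrite ℕₚ.+-suc m m = middle-even (λ a b → q (suc a) (suc b)) m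

middle-odd : ∀ (q : ℕ → ℕ → ℤ) m → middle q (suc (m ℕ.+ m)) ≡ 0ℤ
middle-odd q zero    = refl
middle-odd q (suc m) rewrite ℕₚ.+-suc m m = middle-odd (λ a b → q (suc a) (suc b)) m

∑antidiag-zero : ∀ (q : ℕ → ℕ → ℤ) n → (∀ a b → q a b ≡ 0ℤ) → ∑antidiag q n ≡ 0ℤ
∑antidiag-zero q zero    q≡0 = q≡0 0 0
∑antidiag-zero q (suc n) q≡0 = trans (cong₂ _+_ (q≡0 0 (suc n)) (∑antidiag-zero _ n (λ a b → q≡0 (suc a) b))) refl

𝟙-+≟ : ∀ p p′ n → 𝟙 (p ℕ.+ p′ ℕ.≟ n) ≡ ∑antidiag (λ a b → 𝟙 (p ℕ.≟ a) * 𝟙 (p′ ℕ.≟ b)) n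
𝟙-+≟ zero    zero     zero    = refl
𝟙-+≟ zero    (suc p′) zero    = refl
𝟙-+≟ (suc p) p′       zero    = refl
𝟙-+≟ zero    p′       (suc n) = sym (trans (cong₂ _+_ (ℤₚ.*-identityˡ (𝟙 (p′ ℕ.≟ suc n))) (∑antidiag-zero _ n (λ _ _ → refl)))
                                           (ℤₚ.+-identityʳ _))
𝟙-+≟ (suc p) p′       (suc n) = trans (𝟙-+≟ p p′ n) (sym (ℤₚ.+-identityˡ _))

∑-∑antidiag : ∀ {A : Set} (xs : List A) (F : ℕ → ℕ → A → ℤ) n →
              ∑[ x ← xs ] ∑antidiag (λ a b → F a b x) n ≡ ∑antidiag (λ a b → ∑ xs (F a b)) n
∑-∑antidiag xs F zero    = refl
∑-∑antidiag xs F (suc n) = trans (∑-+ xs (F 0 (suc n)) (λ x → ∑antidiag (λ a b → F (suc a) b x) n))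
  (cong (_+_ (∑ xs (F 0 (suc n)))) (∑-∑antidiag xs (λ a b → F (suc a) b) n))

∑antidiag-sub : ∀ (q q′ : ℕ → ℕ → ℤ) n → ∑antidiag q n - ∑antidiag q′ n ≡ ∑antidiag (λ a b → q a b - q′ a b) n
∑antidiag-sub q q′ zero    = refl
∑antidiag-sub q q′ (suc n) = trans (lemma (q 0 (suc n)) _ (q′ 0 (suc n)) _)
  (cong (_+_ (q 0 (suc n) - q′ 0 (suc n))) (∑antidiag-sub (λ a b → q (suc a) b) (λ a b → q′ (suc a) b) n))
  where lemma : ∀ a b c d → a + b - (c + d) ≡ (a - c) + (b - d)
        lemma = solve-∀

∑antidiag-*ˡ : ∀ c (q : ℕ → ℕ → ℤ) n → c * ∑antidiag q n ≡ ∑antidiag (λ a b → c * q a b) n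
∑antidiag-*ˡ c q zero    = refl
∑antidiag-*ˡ c q (suc n) = trans (ℤₚ.*-distribˡ-+ c (q 0 (suc n)) _)
  (cong (_+_ (c * q 0 (suc n))) (∑antidiag-*ˡ c (λ a b → q (suc a) b) n))

parity : ∀ n → Σ ℕ λ m → n ≡ m ℕ.+ m ⊎ n ≡ suc (m ℕ.+ m)
parity zero    = 0 , inj₁ refl
parity (suc n) with parity n
... | m , inj₁ e = m , inj₂ (cong suc e)
... | m , inj₂ e = suc m , inj₁ (trans (cong suc e) (cong suc (sym (ℕₚ.+-suc m m))))

sub2-even : ∀ (f : PowerSeries) m → sub2 f (m ℕ.+ m) ≡ f m
sub2-even f zero    = refl
sub2-even f (suc m) rewrite ℕₚ.+-suc m m = sub2-even (shift f) m

sub2-odd : ∀ (f : PowerSeries) m → sub2 f (suc (m ℕ.+ m)) ≡ 0ℤ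
sub2-odd f zero    = refl
sub2-odd f (suc m) rewrite ℕₚ.+-suc m m = sub2-odd (shift f) m

zeroᵥ : (k : ℕ) → CVec k
zeroᵥ zero    = leaf (0ℤ + 0ℤ i)
zeroᵥ (suc k) = node (zeroᵥ k) (zeroᵥ k)

-ᵥ_ : CVec k → CVec k
-ᵥ leaf (a + b i) = leaf ((- a) + (- b) i)
-ᵥ node x y       = node (-ᵥ x) (-ᵥ y)

infixl 6 _⊖ᵥ_
_⊖ᵥ_ : CVec k → CVec k → CVec k
x ⊖ᵥ y = x ⊕ᵥ (-ᵥ y)

twiceᵥ : CVec k → CVec k
twiceᵥ x = x ⊕ᵥ x

mulIᵥ : CVec k → CVec k
mulIᵥ (leaf (a + b i)) = leaf ((- b) + a i)
mulIᵥ (node x y)       = node (mulIᵥ x) (mulIᵥ y)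

leaf≡ : ∀ {a b c d} → a ≡ c → b ≡ d → leaf (a + b i) ≡ leaf (c + d i)
leaf≡ = cong₂ (λ a b → leaf (a + b i))

leaf-injective : ∀ {a b c d} → leaf (a + c i) ≡ leaf (b + d i) → a ≡ b × c ≡ d
leaf-injective refl = refl , refl

node-injective : ∀ {a b c d : CVec k} → node a c ≡ node b d → a ≡ b × c ≡ d
node-injective refl = refl , refl

-ᵥ-involutive : (x : CVec k) → -ᵥ (-ᵥ x) ≡ x
-ᵥ-involutive (leaf (a + b i)) = leaf≡ (ℤₚ.neg-involutive a) (ℤₚ.neg-involutive b)
-ᵥ-involutive (node x y)       = cong₂ node (-ᵥ-involutive x) (-ᵥ-involutive y)

x⊖x≡0 : (x : CVec k) → x ⊖ᵥ x ≡ zeroᵥ k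
x⊖x≡0 (leaf (a + b i)) = leaf≡ (ℤₚ.+-inverseʳ a) (ℤₚ.+-inverseʳ b)
x⊖x≡0 (node x y)       = cong₂ node (x⊖x≡0 x) (x⊖x≡0 y)

x⊖0≡x : (x : CVec k) → x ⊖ᵥ zeroᵥ k ≡ x
x⊖0≡x (leaf (a + b i)) = leaf≡ (ℤₚ.+-identityʳ a) (ℤₚ.+-identityʳ b)
x⊖0≡x (node x y)       = cong₂ node (x⊖0≡x x) (x⊖0≡x y)

x⊖y≡-[y⊖x] : (x y : CVec k) → x ⊖ᵥ y ≡ -ᵥ (y ⊖ᵥ x)
x⊖y≡-[y⊖x] (leaf (a + b i)) (leaf (c + d i)) = leaf≡ (lemma a c) (lemma b d)
  where lemma : ∀ a c → a - c ≡ - (c - a)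
        lemma = solve-∀
x⊖y≡-[y⊖x] (node x y) (node z w) = cong₂ node (x⊖y≡-[y⊖x] x z) (x⊖y≡-[y⊖x] y w)

x⊕[y⊖x]≡y : (x y : CVec k) → x ⊕ᵥ (y ⊖ᵥ x) ≡ y
x⊕[y⊖x]≡y (leaf (a + b i)) (leaf (c + d i)) = leaf≡ (lemma a c) (lemma b d)
  where lemma : ∀ a c → a + (c - a) ≡ c
        lemma = solve-∀
x⊕[y⊖x]≡y (node x y) (node z w) = cong₂ node (x⊕[y⊖x]≡y x z) (x⊕[y⊖x]≡y y w)

[x⊕y]⊖x≡y : (x y : CVec k) → (x ⊕ᵥ y) ⊖ᵥ x ≡ y
[x⊕y]⊖x≡y (leaf (a + b i)) (leaf (c + d i)) = leaf≡ (lemma a c) (lemma b d)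
  where lemma : ∀ a c → (a + c) - a ≡ c
        lemma = solve-∀
[x⊕y]⊖x≡y (node x y) (node z w) = cong₂ node ([x⊕y]⊖x≡y x z) ([x⊕y]⊖x≡y y w)

[x⊖y]⊕[y⊖z]≡x⊖z : (x y z : CVec k) → (x ⊖ᵥ y) ⊕ᵥ (y ⊖ᵥ z) ≡ x ⊖ᵥ z
[x⊖y]⊕[y⊖z]≡x⊖z (leaf (a + b i)) (leaf (c + d i)) (leaf (e + f i)) = leaf≡ (lemma a c e) (lemma b d f)
  where lemma : ∀ a c e → (a - c) + (c - e) ≡ a - e
        lemma = solve-∀
[x⊖y]⊕[y⊖z]≡x⊖z (node x y) (node z w) (node u v) = cong₂ node ([x⊖y]⊕[y⊖z]≡x⊖z x z u) ([x⊖y]⊕[y⊖z]≡x⊖z y w v)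

[x⊖z]⊖[y⊖z]≡x⊖y : (x y z : CVec k) → (x ⊖ᵥ z) ⊖ᵥ (y ⊖ᵥ z) ≡ x ⊖ᵥ y
[x⊖z]⊖[y⊖z]≡x⊖y (leaf (a + b i)) (leaf (c + d i)) (leaf (e + f i)) = leaf≡ (lemma a c e) (lemma b d f)
  where lemma : ∀ a c e → (a - e) - (c - e) ≡ a - c
        lemma = solve-∀
[x⊖z]⊖[y⊖z]≡x⊖y (node x y) (node z w) (node u v) = cong₂ node ([x⊖z]⊖[y⊖z]≡x⊖y x z u) ([x⊖z]⊖[y⊖z]≡x⊖y y w v)

[x⊕y]⊖[z⊕w]≡[x⊖z]⊕[y⊖w] : (x y z w : CVec k) → (x ⊕ᵥ y) ⊖ᵥ (z ⊕ᵥ w) ≡ (x ⊖ᵥ z) ⊕ᵥ (y ⊖ᵥ w)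
[x⊕y]⊖[z⊕w]≡[x⊖z]⊕[y⊖w] (leaf (a₁ + a₂ i)) (leaf (b₁ + b₂ i)) (leaf (c₁ + c₂ i)) (leaf (d₁ + d₂ i)) =
  leaf≡ (lemma a₁ b₁ c₁ d₁) (lemma a₂ b₂ c₂ d₂)
  where lemma : ∀ a b c d → (a + b) - (c + d) ≡ (a - c) + (b - d)
        lemma = solve-∀
[x⊕y]⊖[z⊕w]≡[x⊖z]⊕[y⊖w] (node x₁ x₂) (node y₁ y₂) (node z₁ z₂) (node w₁ w₂) =
  cong₂ node ([x⊕y]⊖[z⊕w]≡[x⊖z]⊕[y⊖w] x₁ y₁ z₁ w₁) ([x⊕y]⊖[z⊕w]≡[x⊖z]⊕[y⊖w] x₂ y₂ z₂ w₂)

[x⊖y]⊖[z⊖w]≡[x⊖z]⊖[y⊖w] : (x y z w : CVec k) → (x ⊖ᵥ y) ⊖ᵥ (z ⊖ᵥ w) ≡ (x ⊖ᵥ z) ⊖ᵥ (y ⊖ᵥ w)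
[x⊖y]⊖[z⊖w]≡[x⊖z]⊖[y⊖w] (leaf (a₁ + a₂ i)) (leaf (b₁ + b₂ i)) (leaf (c₁ + c₂ i)) (leaf (d₁ + d₂ i)) =
  leaf≡ (lemma a₁ b₁ c₁ d₁) (lemma a₂ b₂ c₂ d₂)
  where lemma : ∀ a b c d → (a - b) - (c - d) ≡ (a - c) - (b - d)
        lemma = solve-∀
[x⊖y]⊖[z⊖w]≡[x⊖z]⊖[y⊖w] (node x₁ x₂) (node y₁ y₂) (node z₁ z₂) (node w₁ w₂) =
  cong₂ node ([x⊖y]⊖[z⊖w]≡[x⊖z]⊖[y⊖w] x₁ y₁ z₁ w₁) ([x⊖y]⊖[z⊖w]≡[x⊖z]⊖[y⊖w] x₂ y₂ z₂ w₂)

-x⊖y≡-[x⊖y]⊖2y : (x y : CVec k) → (-ᵥ x) ⊖ᵥ y ≡ (-ᵥ (x ⊖ᵥ y)) ⊖ᵥ twiceᵥ y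
-x⊖y≡-[x⊖y]⊖2y (leaf (a + b i)) (leaf (c + d i)) = leaf≡ (lemma a c) (lemma b d)
  where lemma : ∀ a c → (- a) - c ≡ (- (a - c)) - (c + c)
        lemma = solve-∀
-x⊖y≡-[x⊖y]⊖2y (node x y) (node z w) = cong₂ node (-x⊖y≡-[x⊖y]⊖2y x z) (-x⊖y≡-[x⊖y]⊖2y y w)

-ᵥ-⊖ᵥ : (x y : CVec k) → (-ᵥ x) ⊖ᵥ (-ᵥ y) ≡ -ᵥ (x ⊖ᵥ y)
-ᵥ-⊖ᵥ (leaf (a + b i)) (leaf (c + d i)) = leaf≡ (lemma a c) (lemma b d)
  where lemma : ∀ a c → (- a) - (- c) ≡ - (a - c)
        lemma = solve-∀
-ᵥ-⊖ᵥ (node x y) (node z w) = cong₂ node (-ᵥ-⊖ᵥ x z) (-ᵥ-⊖ᵥ y w)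

twiceᵥ-⊕ᵥ : (x y : CVec k) → twiceᵥ x ⊕ᵥ twiceᵥ y ≡ twiceᵥ (x ⊕ᵥ y)
twiceᵥ-⊕ᵥ (leaf (a + b i)) (leaf (c + d i)) = leaf≡ (lemma a c) (lemma b d)
  where lemma : ∀ a c → (a + a) + (c + c) ≡ (a + c) + (a + c)
        lemma = solve-∀
twiceᵥ-⊕ᵥ (node x y) (node z w) = cong₂ node (twiceᵥ-⊕ᵥ x z) (twiceᵥ-⊕ᵥ y w)

twiceᵥ-⊖ᵥ : (x y : CVec k) → twiceᵥ x ⊖ᵥ twiceᵥ y ≡ twiceᵥ (x ⊖ᵥ y)
twiceᵥ-⊖ᵥ (leaf (a + b i)) (leaf (c + d i)) = leaf≡ (lemma a c) (lemma b d)
  where lemma : ∀ a c → (a + a) - (c + c) ≡ (a - c) + (a - c)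
        lemma = solve-∀
twiceᵥ-⊖ᵥ (node x y) (node z w) = cong₂ node (twiceᵥ-⊖ᵥ x z) (twiceᵥ-⊖ᵥ y w)

-ᵥ-twiceᵥ : (x : CVec k) → -ᵥ (twiceᵥ x) ≡ twiceᵥ (-ᵥ x)
-ᵥ-twiceᵥ (leaf (a + b i)) = leaf≡ (ℤₚ.neg-distrib-+ a a) (ℤₚ.neg-distrib-+ b b)
-ᵥ-twiceᵥ (node x y)       = cong₂ node (-ᵥ-twiceᵥ x) (-ᵥ-twiceᵥ y)

mulIᵥ-⊖ᵥ : (x y : CVec k) → mulIᵥ x ⊖ᵥ mulIᵥ y ≡ mulIᵥ (x ⊖ᵥ y)
mulIᵥ-⊖ᵥ (leaf (a + b i)) (leaf (c + d i)) = leaf≡ (lemma b d) refl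
  where lemma : ∀ b d → (- b) - (- d) ≡ - (b - d)
        lemma = solve-∀
mulIᵥ-⊖ᵥ (node x y) (node z w) = cong₂ node (mulIᵥ-⊖ᵥ x z) (mulIᵥ-⊖ᵥ y w)

mulIᵥ-twiceᵥ : (x : CVec k) → mulIᵥ (twiceᵥ x) ≡ twiceᵥ (mulIᵥ x)
mulIᵥ-twiceᵥ (leaf (a + b i)) = leaf≡ (ℤₚ.neg-distrib-+ b b) refl
mulIᵥ-twiceᵥ (node x y)       = cong₂ node (mulIᵥ-twiceᵥ x) (mulIᵥ-twiceᵥ y)

mulIᵥ-negᵥ : (x : CVec k) → mulIᵥ (-ᵥ x) ≡ -ᵥ (mulIᵥ x)
mulIᵥ-negᵥ (leaf (a + b i)) = refl
mulIᵥ-negᵥ (node x y)       = cong₂ node (mulIᵥ-negᵥ x) (mulIᵥ-negᵥ y)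

mulIᵥ² : (x : CVec k) → mulIᵥ (mulIᵥ x) ≡ -ᵥ x
mulIᵥ² (leaf (a + b i)) = refl
mulIᵥ² (node x y)       = cong₂ node (mulIᵥ² x) (mulIᵥ² y)

mul1+iᵥ-⊕ᵥ : (x y : CVec k) → mul1+iᵥ (x ⊕ᵥ y) ≡ mul1+iᵥ x ⊕ᵥ mul1+iᵥ y
mul1+iᵥ-⊕ᵥ (leaf (a + b i)) (leaf (c + d i)) = leaf≡ (on-re a b c d) (on-im a b c d)
  where on-re : ∀ a b c d → (a + c) - (b + d) ≡ (a - b) + (c - d)
        on-re = solve-∀
        on-im : ∀ a b c d → (a + c) + (b + d) ≡ (a + b) + (c + d)
        on-im = solve-∀
mul1+iᵥ-⊕ᵥ (node x y) (node z w) = cong₂ node (mul1+iᵥ-⊕ᵥ x z) (mul1+iᵥ-⊕ᵥ y w)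

mul1+iᵥ-⊖ᵥ : (x y : CVec k) → mul1+iᵥ x ⊖ᵥ mul1+iᵥ y ≡ mul1+iᵥ (x ⊖ᵥ y)
mul1+iᵥ-⊖ᵥ (leaf (a + b i)) (leaf (c + d i)) = leaf≡ (on-re a b c d) (on-im a b c d)
  where on-re : ∀ a b c d → (a - b) - (c - d) ≡ (a - c) - (b - d)
        on-re = solve-∀
        on-im : ∀ a b c d → (a + b) - (c + d) ≡ (a - c) + (b - d)
        on-im = solve-∀
mul1+iᵥ-⊖ᵥ (node x y) (node z w) = cong₂ node (mul1+iᵥ-⊖ᵥ x z) (mul1+iᵥ-⊖ᵥ y w)

mul1+iᵥ² : (x : CVec k) → mul1+iᵥ (mul1+iᵥ x) ≡ twiceᵥ (mulIᵥ x)
mul1+iᵥ² (leaf (a + b i)) = leaf≡ (on-re a b) (on-im a b)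
  where on-re : ∀ a b → (a - b) - (a + b) ≡ (- b) + (- b)
        on-re = solve-∀
        on-im : ∀ a b → (a - b) + (a + b) ≡ a + a
        on-im = solve-∀
mul1+iᵥ² (node x y) = cong₂ node (mul1+iᵥ² x) (mul1+iᵥ² y)

twiceᵥ-zero : ∀ k → twiceᵥ (zeroᵥ k) ≡ zeroᵥ k
twiceᵥ-zero zero    = refl
twiceᵥ-zero (suc k) = cong₂ node (twiceᵥ-zero k) (twiceᵥ-zero k)

-ᵥ-zero : ∀ k → -ᵥ (zeroᵥ k) ≡ zeroᵥ k
-ᵥ-zero zero    = refl
-ᵥ-zero (suc k) = cong₂ node (-ᵥ-zero k) (-ᵥ-zero k)

-- Floor halving; only its values on even integers matter.
half : ℤ → ℤ
half (+ n)    = + ℕ.⌊ n /2⌋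
half -[1+ n ] = -[1+ ℕ.⌊ n /2⌋ ]

half-double : ∀ a → half (a + a) ≡ a
half-double (+ n)    = cong +_ (sym (ℕₚ.n≡⌊n+n/2⌋ n))
half-double -[1+ n ] = cong -[1+_] (sym (ℕₚ.n≡⌈n+n/2⌉ n))

halfᵥ : CVec k → CVec k
halfᵥ (leaf (a + b i)) = leaf (half a + half b i)
halfᵥ (node x y)       = node (halfᵥ x) (halfᵥ y)

halfᵥ-twiceᵥ : (x : CVec k) → halfᵥ (twiceᵥ x) ≡ x
halfᵥ-twiceᵥ (leaf (a + b i)) = leaf≡ (half-double a) (half-double b)
halfᵥ-twiceᵥ (node x y)       = cong₂ node (halfᵥ-twiceᵥ x) (halfᵥ-twiceᵥ y)

twiceᵥ-injective : {x y : CVec k} → twiceᵥ x ≡ twiceᵥ y → x ≡ y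
twiceᵥ-injective {x = x} {y} eq = trans (sym (halfᵥ-twiceᵥ x)) (trans (cong halfᵥ eq) (halfᵥ-twiceᵥ y))

mul1+iᵥ-injective : {x y : CVec k} → mul1+iᵥ x ≡ mul1+iᵥ y → x ≡ y
mul1+iᵥ-injective {x = x} {y} eq = trans (sym (recover x)) (trans (cong undo eq) (recover y))
  where
  undo : CVec k → CVec k
  undo w = -ᵥ mulIᵥ (halfᵥ (mul1+iᵥ w))
  recover : (x : CVec k) → undo (mul1+iᵥ x) ≡ x
  recover x = begin
    -ᵥ mulIᵥ (halfᵥ (mul1+iᵥ (mul1+iᵥ x))) ≡⟨ cong (λ w → -ᵥ mulIᵥ (halfᵥ w)) (mul1+iᵥ² x) ⟩
    -ᵥ mulIᵥ (halfᵥ (twiceᵥ (mulIᵥ x)))    ≡⟨ cong (λ w → -ᵥ mulIᵥ w) (halfᵥ-twiceᵥ (mulIᵥ x)) ⟩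
    -ᵥ mulIᵥ (mulIᵥ x)                     ≡⟨ cong -ᵥ_ (mulIᵥ² x) ⟩
    -ᵥ (-ᵥ x)                              ≡⟨ -ᵥ-involutive x ⟩
    x                                      ∎

data Symmetry : ℕ → Set where
  negate conjugate swapReIm : Symmetry zero
  diag                      : Symmetry k → Symmetry (suc k)
  negateRight swapHalves    : Symmetry (suc k)

act : Symmetry k → CVec k → CVec k
act negate      x                = -ᵥ x
act conjugate   (leaf (a + b i)) = leaf (a + (- b) i)
act swapReIm    (leaf (a + b i)) = leaf (b + a i)
act (diag g)    (node x y)       = node (act g x) (act g y)
act negateRight (node x y)       = node x (-ᵥ y)
act swapHalves  (node x y)       = node y x

act-zero : (g : Symmetry k) → act g (zeroᵥ k) ≡ zeroᵥ k
act-zero negate                = refl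
act-zero conjugate             = refl
act-zero swapReIm              = refl
act-zero (diag g)              = cong₂ node (act-zero g) (act-zero g)
act-zero {suc k} negateRight   = cong (node (zeroᵥ k)) (-ᵥ-zero k)
act-zero swapHalves            = refl

act-involutive : (g : Symmetry k) (x : CVec k) → act g (act g x) ≡ x
act-involutive negate      x                = -ᵥ-involutive x
act-involutive conjugate   (leaf (a + b i)) = leaf≡ refl (ℤₚ.neg-involutive b)
act-involutive swapReIm    (leaf (a + b i)) = refl
act-involutive (diag g)    (node x y)       = cong₂ node (act-involutive g x) (act-involutive g y)
act-involutive negateRight (node x y)       = cong (node x) (-ᵥ-involutive y)
act-involutive swapHalves  (node x y)       = refl

act-⊖ᵥ : (g : Symmetry k) (x y : CVec k) → act g x ⊖ᵥ act g y ≡ act g (x ⊖ᵥ y)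
act-⊖ᵥ negate      x y = -ᵥ-⊖ᵥ x y
act-⊖ᵥ conjugate   (leaf (a + b i)) (leaf (c + d i)) = leaf≡ refl (sym (ℤₚ.neg-distrib-+ b (- d)))
act-⊖ᵥ swapReIm    (leaf _) (leaf _) = refl
act-⊖ᵥ (diag g)    (node x y) (node z w) = cong₂ node (act-⊖ᵥ g x z) (act-⊖ᵥ g y w)
act-⊖ᵥ negateRight (node x y) (node z w) = cong (node (x ⊖ᵥ z)) (-ᵥ-⊖ᵥ y w)
act-⊖ᵥ swapHalves  (node x y) (node z w) = refl

act-twiceᵥ : (g : Symmetry k) (x : CVec k) → act g (twiceᵥ x) ≡ twiceᵥ (act g x)
act-twiceᵥ negate      x                = -ᵥ-twiceᵥ x
act-twiceᵥ conjugate   (leaf (a + b i)) = leaf≡ refl (ℤₚ.neg-distrib-+ b b)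
act-twiceᵥ swapReIm    (leaf _)         = refl
act-twiceᵥ (diag g)    (node x y)       = cong₂ node (act-twiceᵥ g x) (act-twiceᵥ g y)
act-twiceᵥ negateRight (node x y)       = cong (node (twiceᵥ x)) (-ᵥ-twiceᵥ y)
act-twiceᵥ swapHalves  (node x y)       = refl

norm-zero : ∀ k → norm (zeroᵥ k) ≡ 0
norm-zero zero    = refl
norm-zero (suc k) = cong₂ ℕ._+_ (norm-zero k) (norm-zero k)

norm-negᵥ : (x : CVec k) → norm (-ᵥ x) ≡ norm x
norm-negᵥ (leaf (a + b i)) rewrite ℤₚ.∣-i∣≡∣i∣ a | ℤₚ.∣-i∣≡∣i∣ b = refl
norm-negᵥ (node x y) = cong₂ ℕ._+_ (norm-negᵥ x) (norm-negᵥ y)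

norm-act : (g : Symmetry k) (x : CVec k) → norm (act g x) ≡ norm x
norm-act negate      x                = norm-negᵥ x
norm-act conjugate   (leaf (a + b i)) rewrite ℤₚ.∣-i∣≡∣i∣ b = refl
norm-act swapReIm    (leaf (a + b i)) = ℕₚ.+-comm (∣ b ∣ ℕ.* ∣ b ∣) (∣ a ∣ ℕ.* ∣ a ∣)
norm-act (diag g)    (node x y)       = cong₂ ℕ._+_ (norm-act g x) (norm-act g y)
norm-act negateRight (node x y)       = cong (norm x ℕ.+_) (norm-negᵥ y)
norm-act swapHalves  (node x y)       = ℕₚ.+-comm (norm y) (norm x)

norm-mul1+iᵥ : (x : CVec k) → norm (mul1+iᵥ x) ≡ norm x ℕ.+ norm x
norm-mul1+iᵥ (leaf (a + b i)) = ℤₚ.+-injective (begin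
  + (∣ a - b ∣ ℕ.* ∣ a - b ∣ ℕ.+ ∣ a + b ∣ ℕ.* ∣ a + b ∣)    ≡⟨ ℤₚ.pos-+ (∣ a - b ∣ ℕ.* ∣ a - b ∣) _ ⟩
  + (∣ a - b ∣ ℕ.* ∣ a - b ∣) + + (∣ a + b ∣ ℕ.* ∣ a + b ∣) ≡⟨ cong₂ _+_ (∣x∣²≡x² (a - b)) (∣x∣²≡x² (a + b)) ⟩
  (a - b) * (a - b) + (a + b) * (a + b)                    ≡⟨ lemma a b ⟩
  (a * a + b * b) + (a * a + b * b)                        ≡⟨ cong₂ _+_ gnorm≡ gnorm≡ ⟨
  + gnorm (a + b i) + + gnorm (a + b i)                    ≡⟨ ℤₚ.pos-+ (gnorm (a + b i)) _ ⟨
  + (gnorm (a + b i) ℕ.+ gnorm (a + b i))                  ∎)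
  where
  lemma : ∀ a b → (a - b) * (a - b) + (a + b) * (a + b) ≡ (a * a + b * b) + (a * a + b * b)
  lemma = solve-∀
  ∣x∣²≡x² : ∀ x → + (∣ x ∣ ℕ.* ∣ x ∣) ≡ x * x
  ∣x∣²≡x² (+ n)    = ℤₚ.pos-* n n
  ∣x∣²≡x² -[1+ n ] = trans (ℤₚ.pos-* (suc n) (suc n)) (sym (neg*neg (+ suc n)))
    where neg*neg : ∀ a → (- a) * (- a) ≡ a * a
          neg*neg = solve-∀
  gnorm≡ : + gnorm (a + b i) ≡ a * a + b * b
  gnorm≡ = trans (ℤₚ.pos-+ (∣ a ∣ ℕ.* ∣ a ∣) _) (cong₂ _+_ (∣x∣²≡x² a) (∣x∣²≡x² b))
norm-mul1+iᵥ (node x y) rewrite norm-mul1+iᵥ x | norm-mul1+iᵥ y = lemma (norm x) (norm y)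
  where lemma : ∀ a b → a ℕ.+ a ℕ.+ (b ℕ.+ b) ≡ a ℕ.+ b ℕ.+ (a ℕ.+ b)
        lemma = ℕ-Solver.solve-∀

range : ℕ → List ℤ
range zero    = 0ℤ ∷ []
range (suc R) = + suc R ∷ -[1+ R ] ∷ range R

box : (k : ℕ) → ℕ → List (CVec k)
box zero    R = cartesianProductWith (λ a b → leaf (a + b i)) (range R) (range R)
box (suc k) R = cartesianProductWith node (box k R) (box k R)

∑-box-zero : ∀ R (f : CVec zero → ℤ) → ∑ (box zero R) f ≡ ∑[ a ← range R ] ∑[ b ← range R ] f (leaf (a + b i))
∑-box-zero R = ∑-cartesianProductWith _ (range R) (range R)

∑-box-suc : ∀ k R (f : CVec (suc k) → ℤ) → ∑ (box (suc k) R) f ≡ ∑[ x ← box k R ] ∑[ y ← box k R ] f (node x y)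
∑-box-suc k R = ∑-cartesianProductWith node (box k R) (box k R)

∑-range-neg : ∀ R (f : ℤ → ℤ) → ∑[ a ← range R ] f (- a) ≡ ∑ (range R) f
∑-range-neg zero    f = refl
∑-range-neg (suc R) f = begin
  f -[1+ R ] + (f (+ suc R) + ∑[ a ← range R ] f (- a)) ≡⟨ cong (λ s → f -[1+ R ] + (f (+ suc R) + s)) (∑-range-neg R f) ⟩
  f -[1+ R ] + (f (+ suc R) + ∑ (range R) f)            ≡⟨ swap (f -[1+ R ]) (f (+ suc R)) (∑ (range R) f) ⟩
  f (+ suc R) + (f -[1+ R ] + ∑ (range R) f)            ∎
  where swap : ∀ a b c → a + (b + c) ≡ b + (a + c)
        swap = solve-∀

∑-box-negᵥ : ∀ k R (f : CVec k → ℤ) → ∑[ x ← box k R ] f (-ᵥ x) ≡ ∑ (box k R) f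
∑-box-negᵥ zero R f = begin
  ∑[ x ← box zero R ] f (-ᵥ x)                                 ≡⟨ ∑-box-zero R _ ⟩
  ∑[ a ← range R ] ∑[ b ← range R ] f (leaf ((- a) + (- b) i)) ≡⟨ ∑-cong (range R) (λ a → ∑-range-neg R (λ b → f (leaf ((- a) + b i)))) ⟩
  ∑[ a ← range R ] ∑[ b ← range R ] f (leaf ((- a) + b i))     ≡⟨ ∑-range-neg R (λ a → ∑[ b ← range R ] f (leaf (a + b i))) ⟩
  ∑[ a ← range R ] ∑[ b ← range R ] f (leaf (a + b i))         ≡⟨ ∑-box-zero R f ⟨
  ∑ (box zero R) f                                             ∎
∑-box-negᵥ (suc k) R f = begin
  ∑[ x ← box (suc k) R ] f (-ᵥ x)                               ≡⟨ ∑-box-suc k R _ ⟩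
  ∑[ x ← box k R ] ∑[ y ← box k R ] f (node (-ᵥ x) (-ᵥ y))      ≡⟨ ∑-cong (box k R) (λ x → ∑-box-negᵥ k R (λ y → f (node (-ᵥ x) y))) ⟩
  ∑[ x ← box k R ] ∑[ y ← box k R ] f (node (-ᵥ x) y)           ≡⟨ ∑-box-negᵥ k R (λ x → ∑[ y ← box k R ] f (node x y)) ⟩
  ∑[ x ← box k R ] ∑[ y ← box k R ] f (node x y)                ≡⟨ ∑-box-suc k R f ⟨
  ∑ (box (suc k) R) f                                           ∎

∑-box-act : ∀ k R (g : Symmetry k) (f : CVec k → ℤ) → ∑[ x ← box k R ] f (act g x) ≡ ∑ (box k R) f
∑-box-act zero R negate f = ∑-box-negᵥ zero R f
∑-box-act zero R conjugate f = begin
  ∑[ x ← box zero R ] f (act conjugate x)                 ≡⟨ ∑-box-zero R _ ⟩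
  ∑[ a ← range R ] ∑[ b ← range R ] f (leaf (a + (- b) i)) ≡⟨ ∑-cong (range R) (λ a → ∑-range-neg R (λ b → f (leaf (a + b i)))) ⟩
  ∑[ a ← range R ] ∑[ b ← range R ] f (leaf (a + b i))     ≡⟨ ∑-box-zero R f ⟨
  ∑ (box zero R) f                                         ∎
∑-box-act zero R swapReIm f = begin
  ∑[ x ← box zero R ] f (act swapReIm x)               ≡⟨ ∑-box-zero R _ ⟩
  ∑[ a ← range R ] ∑[ b ← range R ] f (leaf (b + a i)) ≡⟨ ∑-comm (range R) (range R) (λ a b → f (leaf (b + a i))) ⟩
  ∑[ b ← range R ] ∑[ a ← range R ] f (leaf (b + a i)) ≡⟨ ∑-box-zero R f ⟨
  ∑ (box zero R) f                                     ∎
∑-box-act (suc k) R (diag g) f = begin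
  ∑[ x ← box (suc k) R ] f (act (diag g) x)                     ≡⟨ ∑-box-suc k R _ ⟩
  ∑[ x ← box k R ] ∑[ y ← box k R ] f (node (act g x) (act g y)) ≡⟨ ∑-cong (box k R) (λ x → ∑-box-act k R g (λ y → f (node (act g x) y))) ⟩
  ∑[ x ← box k R ] ∑[ y ← box k R ] f (node (act g x) y)         ≡⟨ ∑-box-act k R g (λ x → ∑[ y ← box k R ] f (node x y)) ⟩
  ∑[ x ← box k R ] ∑[ y ← box k R ] f (node x y)                 ≡⟨ ∑-box-suc k R f ⟨
  ∑ (box (suc k) R) f                                            ∎
∑-box-act (suc k) R negateRight f = begin
  ∑[ x ← box (suc k) R ] f (act negateRight x)           ≡⟨ ∑-box-suc k R _ ⟩
  ∑[ x ← box k R ] ∑[ y ← box k R ] f (node x (-ᵥ y))    ≡⟨ ∑-cong (box k R) (λ x → ∑-box-negᵥ k R (λ y → f (node x y))) ⟩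
  ∑[ x ← box k R ] ∑[ y ← box k R ] f (node x y)         ≡⟨ ∑-box-suc k R f ⟨
  ∑ (box (suc k) R) f                                    ∎
∑-box-act (suc k) R swapHalves f = begin
  ∑[ x ← box (suc k) R ] f (act swapHalves x)     ≡⟨ ∑-box-suc k R _ ⟩
  ∑[ x ← box k R ] ∑[ y ← box k R ] f (node y x)  ≡⟨ ∑-comm (box k R) (box k R) (λ x y → f (node y x)) ⟩
  ∑[ y ← box k R ] ∑[ x ← box k R ] f (node y x)  ≡⟨ ∑-box-suc k R f ⟨
  ∑ (box (suc k) R) f                             ∎

∈-range : ∀ R a → ∣ a ∣ ≤ R → a ∈ range R
∈-range zero    (+ zero)  _  = here refl
∈-range (suc R) (+ zero)  _  = there (there (∈-range R (+ zero) z≤n))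
∈-range (suc R) (+ suc n) (s≤s n≤R) with ℕₚ.m≤n⇒m<n∨m≡n n≤R
... | inj₁ n<R  = there (there (∈-range R (+ suc n) n<R))
... | inj₂ refl = here refl
∈-range (suc R) -[1+ n ]  (s≤s n≤R) with ℕₚ.m≤n⇒m<n∨m≡n n≤R
... | inj₁ n<R  = there (there (∈-range R -[1+ n ] n<R))
... | inj₂ refl = there (here refl)

range-bound : ∀ R {a} → a ∈ range R → ∣ a ∣ ≤ R
range-bound zero    (here refl)         = z≤n
range-bound (suc R) (here refl)         = ℕₚ.≤-refl
range-bound (suc R) (there (here refl)) = ℕₚ.≤-refl
range-bound (suc R) (there (there a∈))  = ℕₚ.m≤n⇒m≤1+n (range-bound R a∈)

range-unique : ∀ R → Unique (range R)
range-unique zero    = [] ∷ []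
range-unique (suc R) = ((λ ()) ∷ All.tabulate (beyond refl)) ∷ All.tabulate (beyond refl) ∷ range-unique R
  where
  beyond : ∀ {a b} → ∣ b ∣ ≡ suc R → a ∈ range R → b ≢ a
  beyond ∣b∣≡ a∈ refl = ℕₚ.1+n≰n (subst (_≤ R) ∣b∣≡ (range-bound R a∈))

∈-box : ∀ k R (x : CVec k) → norm x ≤ R → x ∈ box k R
∈-box zero R (leaf (a + b i)) ≤R = ∈-cartesianProductWith _
  (∈-range R a (ℕₚ.≤-trans (n≤n*n ∣ a ∣) (ℕₚ.m+n≤o⇒m≤o (∣ a ∣ ℕ.* ∣ a ∣) ≤R)))
  (∈-range R b (ℕₚ.≤-trans (n≤n*n ∣ b ∣) (ℕₚ.m+n≤o⇒n≤o (∣ a ∣ ℕ.* ∣ a ∣) ≤R)))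
  where
  n≤n*n : ∀ n → n ≤ n ℕ.* n
  n≤n*n zero    = z≤n
  n≤n*n (suc n) = ℕₚ.m≤m+n (suc n) (n ℕ.* suc n)
∈-box (suc k) R (node x y) ≤R = ∈-cartesianProductWith node
  (∈-box k R x (ℕₚ.m+n≤o⇒m≤o (norm x) ≤R)) (∈-box k R y (ℕₚ.m+n≤o⇒n≤o (norm x) ≤R))

box-unique : ∀ k R → Unique (box k R)
box-unique zero    R = Unique.cartesianProductWith⁺ _ leaf-injective (range-unique R) (range-unique R)
box-unique (suc k) R = Unique.cartesianProductWith⁺ node node-injective (box-unique k R) (box-unique k R)

-- Orbit divisibility

-- The form of "every orbit of the generators act on xs, other than {z},
-- has size divisible by 2^e" that survives passing to invariant weights.
OrbitDivisible : {A G : Set} → List A → A → (G → A → A) → ℕ → Set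
OrbitDivisible {A} xs z act e =
  ∀ (f : A → ℤ) d → (∀ g x → f (act g x) ≡ f x) → (∀ x → d ∣ f x) → pow2 e * d ∣ ∑ xs f - f z

range-orbitDivisible : ∀ R → OrbitDivisible (range R) 0ℤ (λ (_ : ⊤) → -_) 1
range-orbitDivisible zero    f d _   _   = subst (_ ∣_) (sym (lemma (f 0ℤ))) (∣0 _)
  where lemma : ∀ a → a + 0ℤ - a ≡ 0ℤ
        lemma = solve-∀
range-orbitDivisible (suc R) f d inv d∣f =
  subst (_ ∣_) (sym split) (∣m∣n⇒∣m+n (*-pres-∣ (∣-refl {+ 2}) (d∣f (+ suc R))) (range-orbitDivisible R f d inv d∣f))
  where
  lemma : ∀ a s z → a + (a + s) - z ≡ + 2 * a + (s - z)
  lemma = solve-∀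
  split : ∑ (range (suc R)) f - f 0ℤ ≡ pow2 1 * f (+ suc R) + (∑ (range R) f - f 0ℤ)
  split = trans (cong (λ t → f (+ suc R) + (t + ∑ (range R) f) - f 0ℤ) (inv tt (+ suc R)))
                (lemma (f (+ suc R)) (∑ (range R) f) (f 0ℤ))

module ProductStep {A G : Set} (xs : List A) (z : A) (neg : A → A) (act : G → A → A) (e : ℕ)
  (∑-neg-invariant : ∀ f → ∑[ x ← xs ] f (neg x) ≡ ∑ xs f) (neg-z : neg z ≡ z)
  (∑-act-invariant : ∀ g f → ∑[ x ← xs ] f (act g x) ≡ ∑ xs f) (act-z : ∀ g → act g z ≡ z)
  (neg-divisible : OrbitDivisible xs z (λ (_ : ⊤) → neg) 1)
  (act-divisible : OrbitDivisible xs z act e)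
  where

  ∑² : (A → A → ℤ) → ℤ
  ∑² H = ∑[ x ← xs ] ∑[ y ← xs ] H x y

  ∑²-neg-divisible : ∀ (H : A → A → ℤ) d → (∀ x y → H (neg x) (neg y) ≡ H x y) → (∀ x y → d ∣ H x y) →
                     pow2 1 * d ∣ ∑² H - H z z
  ∑²-neg-divisible H d inv d∣H = subst (_ ∣_) (sym (split (∑² H) (W z) (H z z))) (∣m∣n⇒∣m+n outer inner)
    where
    split : ∀ a b c → a - c ≡ (a - b) + (b - c)
    split = solve-∀
    W : A → ℤ
    W x = ∑ xs (H x)
    W-inv : ∀ x → W (neg x) ≡ W x
    W-inv x = trans (sym (∑-neg-invariant (H (neg x)))) (∑-cong xs (inv x))
    outer : pow2 1 * d ∣ ∑ xs W - W z
    outer = neg-divisible W d (λ _ → W-inv) (λ x → ∑-∣ xs (d∣H x))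
    inner : pow2 1 * d ∣ W z - H z z
    inner = neg-divisible (H z) d (λ _ y → trans (cong (λ t → H t (neg y)) (sym neg-z)) (inv z y)) (d∣H z)

  -- With the column b x = H x z and F x = (row sum at x) - b x, ∑² H - H z z is
  -- (∑ F - F z) + 2 (∑ b - b z), where F and b are invariant and 2d ∣ F by
  -- negating the second entry.
  ∑²-act-divisible : ∀ (H : A → A → ℤ) d →
                     (∀ g x y → H (act g x) (act g y) ≡ H x y) → (∀ x y → H x (neg y) ≡ H x y) →
                     (∀ x y → H y x ≡ H x y) → (∀ x y → d ∣ H x y) →
                     pow2 (suc e) * d ∣ ∑² H - H z z
  ∑²-act-divisible H d diag-inv right-inv sym-H d∣H =
    subst (_ ∣_) (sym split) (∣m∣n⇒∣m+n (subst (_∣ (∑ xs F - F z)) F-scale F-divisible)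
                                        (subst (_∣ (+ 2 * (∑ xs b - b z))) b-scale b-divisible))
    where
    b : A → ℤ
    b x = H x z
    F : A → ℤ
    F x = ∑ xs (H x) - b x
    b-inv : ∀ g x → b (act g x) ≡ b x
    b-inv g x = trans (cong (H (act g x)) (sym (act-z g))) (diag-inv g x z)
    F-inv : ∀ g x → F (act g x) ≡ F x
    F-inv g x = cong₂ _-_ (trans (sym (∑-act-invariant g (H (act g x)))) (∑-cong xs (diag-inv g x))) (b-inv g x)
    F-divisible : pow2 e * (pow2 1 * d) ∣ ∑ xs F - F z
    F-divisible = act-divisible F (pow2 1 * d) F-inv (λ x → neg-divisible (H x) d (λ _ → right-inv x) (d∣H x))
    b-divisible : + 2 * (pow2 e * d) ∣ + 2 * (∑ xs b - b z)
    b-divisible = *-monoʳ-∣ (+ 2) (act-divisible b d b-inv (λ x → d∣H x z))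
    reassoc : ∀ p q r → p * (q * r) ≡ q * p * r
    reassoc = solve-∀
    F-scale : pow2 e * (pow2 1 * d) ≡ pow2 (suc e) * d
    F-scale = trans (reassoc (pow2 e) (pow2 1) d) (cong (_* d) (sym (pow2-suc e)))
    b-scale : + 2 * (pow2 e * d) ≡ pow2 (suc e) * d
    b-scale = trans (sym (ℤₚ.*-assoc (+ 2) (pow2 e) d)) (cong (_* d) (sym (pow2-suc e)))
    F-z : F z ≡ ∑ xs b - H z z
    F-z = cong (_- H z z) (∑-cong xs (λ y → sym-H y z))
    lemma : ∀ f s h → f + s - h ≡ (f - (s - h)) + + 2 * (s - h)
    lemma = solve-∀
    split : ∑² H - H z z ≡ (∑ xs F - F z) + + 2 * (∑ xs b - b z)
    split = begin
      ∑² H - H z z                                           ≡⟨ cong (_- H z z) (∑-cong xs (λ x → sym (m-n+n≡m (∑ xs (H x)) (b x)))) ⟩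
      ∑[ x ← xs ] (F x + b x) - H z z                        ≡⟨ cong (_- H z z) (∑-+ xs F b) ⟩
      ∑ xs F + ∑ xs b - H z z                                ≡⟨ lemma (∑ xs F) (∑ xs b) (H z z) ⟩
      (∑ xs F - (∑ xs b - H z z)) + + 2 * (∑ xs b - H z z)   ≡⟨ cong (λ t → (∑ xs F - t) + + 2 * (∑ xs b - H z z)) F-z ⟨
      (∑ xs F - F z) + + 2 * (∑ xs b - b z)                  ∎

box-orbitDivisible : ∀ k R → OrbitDivisible (box k R) (zeroᵥ k) (λ (_ : ⊤) → -ᵥ_) 1
                           × OrbitDivisible (box k R) (zeroᵥ k) act (suc (suc k))
box-orbitDivisible zero R = neg-divisible , act-divisible
  where
  open ProductStep (range R) 0ℤ -_ (λ (_ : ⊤) → -_) 1 (∑-range-neg R) refl (λ _ → ∑-range-neg R) (λ _ → refl)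
                   (range-orbitDivisible R) (range-orbitDivisible R)
  on-box : ∀ {c} (f : CVec zero → ℤ) → c ∣ ∑² (λ a b → f (leaf (a + b i))) - f (zeroᵥ zero) →
           c ∣ ∑ (box zero R) f - f (zeroᵥ zero)
  on-box f = subst (λ t → _ ∣ t - f (zeroᵥ zero)) (sym (∑-box-zero R f))
  neg-divisible : OrbitDivisible (box zero R) (zeroᵥ zero) (λ (_ : ⊤) → -ᵥ_) 1
  neg-divisible f d inv d∣f = on-box f
    (∑²-neg-divisible (λ a b → f (leaf (a + b i))) d (λ a b → inv tt (leaf (a + b i))) (λ a b → d∣f (leaf (a + b i))))
  act-divisible : OrbitDivisible (box zero R) (zeroᵥ zero) act 2
  act-divisible f d inv d∣f = on-box f
    (∑²-act-divisible (λ a b → f (leaf (a + b i))) d (λ _ a b → inv negate (leaf (a + b i)))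
      (λ a b → inv conjugate (leaf (a + b i))) (λ a b → inv swapReIm (leaf (a + b i))) (λ a b → d∣f (leaf (a + b i))))
box-orbitDivisible (suc k) R = neg-divisible , act-divisible
  where
  open ProductStep (box k R) (zeroᵥ k) -ᵥ_ act (suc (suc k)) (∑-box-negᵥ k R) (-ᵥ-zero k) (∑-box-act k R) act-zero
                   (proj₁ (box-orbitDivisible k R)) (proj₂ (box-orbitDivisible k R))
  on-box : ∀ {c} (f : CVec (suc k) → ℤ) → c ∣ ∑² (λ x y → f (node x y)) - f (zeroᵥ (suc k)) →
           c ∣ ∑ (box (suc k) R) f - f (zeroᵥ (suc k))
  on-box f = subst (λ t → _ ∣ t - f (zeroᵥ (suc k))) (sym (∑-box-suc k R f))
  neg-divisible : OrbitDivisible (box (suc k) R) (zeroᵥ (suc k)) (λ (_ : ⊤) → -ᵥ_) 1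
  neg-divisible f d inv d∣f = on-box f
    (∑²-neg-divisible (λ x y → f (node x y)) d (λ x y → inv tt (node x y)) (λ x y → d∣f (node x y)))
  act-divisible : OrbitDivisible (box (suc k) R) (zeroᵥ (suc k)) act (suc (suc (suc k)))
  act-divisible f d inv d∣f = on-box f
    (∑²-act-divisible (λ x y → f (node x y)) d (λ g x y → inv (diag g) (node x y))
      (λ x y → inv negateRight (node x y)) (λ x y → inv swapHalves (node x y)) (λ x y → d∣f (node x y)))

-- BW and its sublattices (1+i) BW and 2 BW

-- InL k, InM k and In2L k are BW k, (1+i) BW k and 2 BW k, described
-- recursively so that membership is decidable.
mutual
  InL : (k : ℕ) → CVec k → Set
  InL zero    _          = ⊤
  InL (suc k) (node x y) = InL k x × InM k (y ⊖ᵥ x)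

  InM : (k : ℕ) → CVec k → Set
  InM zero    (leaf (a + b i)) = + 2 ∣ a + b
  InM (suc k) (node x y)       = InM k x × In2L k (y ⊖ᵥ x)

  In2L : (k : ℕ) → CVec k → Set
  In2L k w = Σ (CVec k) λ v → InL k v × w ≡ twiceᵥ v

2∣a+a : ∀ a → + 2 ∣ a + a
2∣a+a a = divides a (lemma a)
  where lemma : ∀ a → a + a ≡ a * + 2
        lemma = solve-∀

mutual
  InL-zero : ∀ k → InL k (zeroᵥ k)
  InL-zero zero    = tt
  InL-zero (suc k) = InL-zero k , subst (InM k) (sym (x⊖x≡0 (zeroᵥ k))) (InM-zero k)

  InM-zero : ∀ k → InM k (zeroᵥ k)
  InM-zero zero    = ∣0 (+ 2)
  InM-zero (suc k) = InM-zero k , zeroᵥ k , InL-zero k , trans (x⊖x≡0 (zeroᵥ k)) (sym (twiceᵥ-zero k))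

mutual
  InL-⊕ : ∀ k {x y} → InL k x → InL k y → InL k (x ⊕ᵥ y)
  InL-⊕ zero    _ _ = tt
  InL-⊕ (suc k) {node x₁ y₁} {node x₂ y₂} (l₁ , m₁) (l₂ , m₂) =
    InL-⊕ k l₁ l₂ , subst (InM k) (sym ([x⊕y]⊖[z⊕w]≡[x⊖z]⊕[y⊖w] y₁ y₂ x₁ x₂)) (InM-⊕ k m₁ m₂)

  InM-⊕ : ∀ k {x y} → InM k x → InM k y → InM k (x ⊕ᵥ y)
  InM-⊕ zero {leaf (a + b i)} {leaf (c + d i)} p q = subst (+ 2 ∣_) (lemma a b c d) (∣m∣n⇒∣m+n p q)
    where lemma : ∀ a b c d → (a + b) + (c + d) ≡ (a + c) + (b + d)
          lemma = solve-∀
  InM-⊕ (suc k) {node x₁ y₁} {node x₂ y₂} (m₁ , w₁) (m₂ , w₂) =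
    InM-⊕ k m₁ m₂ , subst (In2L k) (sym ([x⊕y]⊖[z⊕w]≡[x⊖z]⊕[y⊖w] y₁ y₂ x₁ x₂)) (In2L-⊕ k w₁ w₂)

  In2L-⊕ : ∀ k {x y} → In2L k x → In2L k y → In2L k (x ⊕ᵥ y)
  In2L-⊕ k (v , l , refl) (w , l′ , refl) = v ⊕ᵥ w , InL-⊕ k l l′ , twiceᵥ-⊕ᵥ v w

mutual
  InL-neg : ∀ k {x} → InL k x → InL k (-ᵥ x)
  InL-neg zero    _ = tt
  InL-neg (suc k) {node x y} (l , m) = InL-neg k l , subst (InM k) (sym (-ᵥ-⊖ᵥ y x)) (InM-neg k m)

  InM-neg : ∀ k {x} → InM k x → InM k (-ᵥ x)
  InM-neg zero    {leaf (a + b i)} p = subst (+ 2 ∣_) (ℤₚ.neg-distrib-+ a b) (∣m⇒∣-m p)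
  InM-neg (suc k) {node x y} (m , w) = InM-neg k m , subst (In2L k) (sym (-ᵥ-⊖ᵥ y x)) (In2L-neg k w)

  In2L-neg : ∀ k {x} → In2L k x → In2L k (-ᵥ x)
  In2L-neg k (v , l , refl) = -ᵥ v , InL-neg k l , -ᵥ-twiceᵥ v

InM-⊖ : ∀ k {x y} → InM k x → InM k y → InM k (x ⊖ᵥ y)
InM-⊖ k p q = InM-⊕ k p (InM-neg k q)

In2L-⊖ : ∀ k {x y} → In2L k x → In2L k y → In2L k (x ⊖ᵥ y)
In2L-⊖ k p q = In2L-⊕ k p (In2L-neg k q)

mutual
  InM⇒InL : ∀ k {x} → InM k x → InL k x
  InM⇒InL zero    _       = tt
  InM⇒InL (suc k) {node _ _} (m , w) = InM⇒InL k m , In2L⇒InM k w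

  In2L⇒InM : ∀ k {x} → In2L k x → InM k x
  In2L⇒InM k (v , l , refl) = InL⇒InM-twice k l

  InL⇒InM-twice : ∀ k {x} → InL k x → InM k (twiceᵥ x)
  InL⇒InM-twice zero    {leaf (a + b i)} _ = subst (+ 2 ∣_) (lemma a b) (2∣a+a (a + b))
    where lemma : ∀ a b → (a + b) + (a + b) ≡ (a + a) + (b + b)
          lemma = solve-∀
  InL⇒InM-twice (suc k) {node x y} (l , m) = InL⇒InM-twice k l , y ⊖ᵥ x , InM⇒InL k m , twiceᵥ-⊖ᵥ y x

InL-shift : ∀ k {x y} → InL k x → InM k (y ⊖ᵥ x) → InL k y
InL-shift k {x} {y} l m = subst (InL k) (x⊕[y⊖x]≡y x y) (InL-⊕ k l (InM⇒InL k m))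

InM-shift : ∀ k {x y} → InM k x → In2L k (y ⊖ᵥ x) → InM k y
InM-shift k {x} {y} m w = subst (InM k) (x⊕[y⊖x]≡y x y) (InM-⊕ k m (In2L⇒InM k w))

mutual
  InL-mulI : ∀ k {x} → InL k x → InL k (mulIᵥ x)
  InL-mulI zero    _ = tt
  InL-mulI (suc k) {node x y} (l , m) = InL-mulI k l , subst (InM k) (sym (mulIᵥ-⊖ᵥ y x)) (InM-mulI k m)

  InM-mulI : ∀ k {x} → InM k x → InM k (mulIᵥ x)
  InM-mulI zero    {leaf (a + b i)} p = subst (+ 2 ∣_) (lemma a b) (∣m∣n⇒∣m-n p (2∣a+a b))
    where lemma : ∀ a b → (a + b) - (b + b) ≡ (- b) + a
          lemma = solve-∀
  InM-mulI (suc k) {node x y} (m , w) = InM-mulI k m , subst (In2L k) (sym (mulIᵥ-⊖ᵥ y x)) (In2L-mulI k w)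

  In2L-mulI : ∀ k {x} → In2L k x → In2L k (mulIᵥ x)
  In2L-mulI k (v , l , refl) = mulIᵥ v , InL-mulI k l , mulIᵥ-twiceᵥ v

mutual
  InL-act : ∀ k (g : Symmetry k) {x} → InL k x → InL k (act g x)
  InL-act zero    g _ = tt
  InL-act (suc k) (diag g)    {node x y} (l , m) = InL-act k g l , subst (InM k) (sym (act-⊖ᵥ g y x)) (InM-act k g m)
  InL-act (suc k) negateRight {node x y} (l , m) =
    l , subst (InM k) (sym (-x⊖y≡-[x⊖y]⊖2y y x)) (InM-⊖ k (InM-neg k m) (InL⇒InM-twice k l))
  InL-act (suc k) swapHalves  {node x y} (l , m) = InL-shift k l m , subst (InM k) (sym (x⊖y≡-[y⊖x] x y)) (InM-neg k m)

  InM-act : ∀ k (g : Symmetry k) {x} → InM k x → InM k (act g x)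
  InM-act zero    negate      {x@(leaf _)} p = InM-neg zero {x} p
  InM-act zero    conjugate   {leaf (a + b i)} p = subst (+ 2 ∣_) (lemma a b) (∣m∣n⇒∣m-n p (2∣a+a b))
    where lemma : ∀ a b → (a + b) - (b + b) ≡ a + (- b)
          lemma = solve-∀
  InM-act zero    swapReIm    {leaf (a + b i)} p = subst (+ 2 ∣_) (ℤₚ.+-comm a b) p
  InM-act (suc k) (diag g)    {node x y} (m , w) = InM-act k g m , subst (In2L k) (sym (act-⊖ᵥ g y x)) (In2L-act k g w)
  InM-act (suc k) negateRight {node x y} (m , w) =
    m , subst (In2L k) (sym (-x⊖y≡-[x⊖y]⊖2y y x)) (In2L-⊖ k (In2L-neg k w) (x , InM⇒InL k m , refl))
  InM-act (suc k) swapHalves  {node x y} (m , w) = InM-shift k m w , subst (In2L k) (sym (x⊖y≡-[y⊖x] x y)) (In2L-neg k w)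

  In2L-act : ∀ k (g : Symmetry k) {x} → In2L k x → In2L k (act g x)
  In2L-act k g (v , l , refl) = act g v , InL-act k g l , act-twiceᵥ g v

mutual
  InM-act-⊖ : ∀ k (g : Symmetry k) {x} → InL k x → InM k (act g x ⊖ᵥ x)
  InM-act-⊖ zero negate    {leaf (a + b i)} _ = subst (+ 2 ∣_) (lemma a b) (2∣a+a ((- a) + (- b)))
    where lemma : ∀ a b → ((- a) + (- b)) + ((- a) + (- b)) ≡ ((- a) + (- a)) + ((- b) + (- b))
          lemma = solve-∀
  InM-act-⊖ zero conjugate {leaf (a + b i)} _ = subst (+ 2 ∣_) (lemma a b) (2∣a+a (- b))
    where lemma : ∀ a b → (- b) + (- b) ≡ (a + (- a)) + ((- b) + (- b))
          lemma = solve-∀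
  InM-act-⊖ zero swapReIm  {leaf (a + b i)} _ = subst (+ 2 ∣_) (lemma a b) (∣0 (+ 2))
    where lemma : ∀ a b → 0ℤ ≡ (b + (- a)) + (a + (- b))
          lemma = solve-∀
  InM-act-⊖ (suc k) (diag g) {node x y} (l , m) = InM-act-⊖ k g l , subst (In2L k) regroup (In2L-act-⊖ k g m)
    where
    regroup : act g (y ⊖ᵥ x) ⊖ᵥ (y ⊖ᵥ x) ≡ (act g y ⊖ᵥ y) ⊖ᵥ (act g x ⊖ᵥ x)
    regroup = trans (cong (_⊖ᵥ (y ⊖ᵥ x)) (sym (act-⊖ᵥ g y x))) ([x⊖y]⊖[z⊖w]≡[x⊖z]⊖[y⊖w] (act g y) (act g x) y x)
  InM-act-⊖ (suc k) negateRight {node x y} (l , m) =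
    subst (InM k) (sym (x⊖x≡0 x)) (InM-zero k) ,
    -ᵥ y , InL-neg k (InL-shift k l m) , trans (cong ((-ᵥ y ⊖ᵥ y) ⊖ᵥ_) (x⊖x≡0 x)) (x⊖0≡x _)
  InM-act-⊖ (suc k) swapHalves {node x y} (l , m) =
    m , x ⊖ᵥ y , InM⇒InL k (subst (InM k) (sym (x⊖y≡-[y⊖x] x y)) (InM-neg k m)) , cong ((x ⊖ᵥ y) ⊕ᵥ_) (sym (x⊖y≡-[y⊖x] x y))

  In2L-act-⊖ : ∀ k (g : Symmetry k) {x} → InM k x → In2L k (act g x ⊖ᵥ x)
  In2L-act-⊖ zero negate    {leaf (a + b i)} _ = leaf ((- a) + (- b) i) , tt , refl
  In2L-act-⊖ zero conjugate {leaf (a + b i)} _ = leaf (0ℤ + (- b) i) , tt , leaf≡ (ℤₚ.+-inverseʳ a) refl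
  In2L-act-⊖ zero swapReIm  {leaf (a + b i)} (divides q a+b≡2q) =
    leaf ((q - a) + (a - q) i) , tt , leaf≡ (on-re a b q a+b≡2q) (on-im a b q a+b≡2q)
    where
    on-re : ∀ a b q → a + b ≡ q * + 2 → b - a ≡ (q - a) + (q - a)
    on-re a b q eq = trans (lemma₁ a b) (trans (cong (_- (a + a)) eq) (lemma₂ a q))
      where lemma₁ : ∀ a b → b - a ≡ (a + b) - (a + a)
            lemma₁ = solve-∀
            lemma₂ : ∀ a q → q * + 2 - (a + a) ≡ (q - a) + (q - a)
            lemma₂ = solve-∀
    on-im : ∀ a b q → a + b ≡ q * + 2 → a - b ≡ (a - q) + (a - q)
    on-im a b q eq = trans (lemma₁ a b) (trans (cong (_-_ (a + a)) eq) (lemma₂ a q))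
      where lemma₁ : ∀ a b → a - b ≡ (a + a) - (a + b)
            lemma₁ = solve-∀
            lemma₂ : ∀ a q → (a + a) - q * + 2 ≡ (a - q) + (a - q)
            lemma₂ = solve-∀
  In2L-act-⊖ (suc k) (diag g) {node x y} (m , w@(u , lu , y⊖x≡2u))
    with In2L-act-⊖ k g m | In2L-act-⊖ k g (InM-shift k m w)
  ... | v₁ , l₁ , gx⊖x≡2v₁ | v₂ , l₂ , gy⊖y≡2v₂ =
    node v₁ v₂ , (l₁ , subst (InM k) (sym (twiceᵥ-injective doubled)) (InM-act-⊖ k g lu)) , cong₂ node gx⊖x≡2v₁ gy⊖y≡2v₂
    where
    doubled : twiceᵥ (v₂ ⊖ᵥ v₁) ≡ twiceᵥ (act g u ⊖ᵥ u)
    doubled = begin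
      twiceᵥ (v₂ ⊖ᵥ v₁)                         ≡⟨ twiceᵥ-⊖ᵥ v₂ v₁ ⟨
      twiceᵥ v₂ ⊖ᵥ twiceᵥ v₁                    ≡⟨ cong₂ _⊖ᵥ_ gy⊖y≡2v₂ gx⊖x≡2v₁ ⟨
      (act g y ⊖ᵥ y) ⊖ᵥ (act g x ⊖ᵥ x)          ≡⟨ [x⊖y]⊖[z⊖w]≡[x⊖z]⊖[y⊖w] (act g y) y (act g x) x ⟩
      (act g y ⊖ᵥ act g x) ⊖ᵥ (y ⊖ᵥ x)          ≡⟨ cong (_⊖ᵥ (y ⊖ᵥ x)) (act-⊖ᵥ g y x) ⟩
      act g (y ⊖ᵥ x) ⊖ᵥ (y ⊖ᵥ x)                ≡⟨ cong (λ t → act g t ⊖ᵥ t) y⊖x≡2u ⟩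
      act g (twiceᵥ u) ⊖ᵥ twiceᵥ u              ≡⟨ cong (_⊖ᵥ twiceᵥ u) (act-twiceᵥ g u) ⟩
      twiceᵥ (act g u) ⊖ᵥ twiceᵥ u              ≡⟨ twiceᵥ-⊖ᵥ (act g u) u ⟩
      twiceᵥ (act g u ⊖ᵥ u)                     ∎
  In2L-act-⊖ (suc k) negateRight {node x y} (m , w) =
    node (zeroᵥ k) (-ᵥ y) , (InL-zero k , subst (InM k) (sym (x⊖0≡x (-ᵥ y))) (InM-neg k (InM-shift k m w))) ,
    cong₂ node (trans (x⊖x≡0 x) (sym (twiceᵥ-zero k))) refl
  In2L-act-⊖ (suc k) swapHalves {node x y} (m , (u , lu , y⊖x≡2u)) =
    node u (-ᵥ u) , (lu , InL⇒InM-twice k (InL-neg k lu)) ,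
    cong₂ node y⊖x≡2u (trans (x⊖y≡-[y⊖x] x y) (trans (cong -ᵥ_ y⊖x≡2u) (-ᵥ-twiceᵥ u)))

mutual
  InL⇒InM-mul1+i : ∀ k {x} → InL k x → InM k (mul1+iᵥ x)
  InL⇒InM-mul1+i zero    {leaf (a + b i)} _ = subst (+ 2 ∣_) (lemma a b) (2∣a+a a)
    where lemma : ∀ a b → a + a ≡ (a - b) + (a + b)
          lemma = solve-∀
  InL⇒InM-mul1+i (suc k) {node x y} (l , m) with InM⇒mul1+i k m
  ... | r , lr , y⊖x≡[1+i]r = InL⇒InM-mul1+i k l , mulIᵥ r , InL-mulI k lr , (begin
    mul1+iᵥ y ⊖ᵥ mul1+iᵥ x   ≡⟨ mul1+iᵥ-⊖ᵥ y x ⟩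
    mul1+iᵥ (y ⊖ᵥ x)         ≡⟨ cong mul1+iᵥ y⊖x≡[1+i]r ⟩
    mul1+iᵥ (mul1+iᵥ r)      ≡⟨ mul1+iᵥ² r ⟩
    twiceᵥ (mulIᵥ r)         ∎)

  InM⇒mul1+i : ∀ k {x} → InM k x → Σ (CVec k) λ v → InL k v × x ≡ mul1+iᵥ v
  InM⇒mul1+i zero {leaf (a + b i)} (divides q a+b≡2q) =
    leaf (q + (q - a) i) , tt , leaf≡ (lemma₁ a q) (trans (lemma₂ a b) (trans (cong (_- a) a+b≡2q) (lemma₃ a q)))
    where lemma₁ : ∀ a q → a ≡ q - (q - a)
          lemma₁ = solve-∀
          lemma₂ : ∀ a b → b ≡ (a + b) - a
          lemma₂ = solve-∀
          lemma₃ : ∀ a q → q * + 2 - a ≡ q + (q - a)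
          lemma₃ = solve-∀
  InM⇒mul1+i (suc k) {node x y} (m , u , lu , y⊖x≡2u) with InM⇒mul1+i k m
  ... | p , lp , x≡[1+i]p =
    node p (p ⊕ᵥ mul1+iᵥ r) ,
    (lp , subst (InM k) (sym ([x⊕y]⊖x≡y p (mul1+iᵥ r))) (InL⇒InM-mul1+i k (InL-neg k (InL-mulI k lu)))) ,
    cong₂ node x≡[1+i]p y≡
    where
    r : CVec k
    r = -ᵥ mulIᵥ u
    i·r≡u : mulIᵥ r ≡ u
    i·r≡u = trans (mulIᵥ-negᵥ (mulIᵥ u)) (trans (cong -ᵥ_ (mulIᵥ² u)) (-ᵥ-involutive u))
    y≡ : y ≡ mul1+iᵥ (p ⊕ᵥ mul1+iᵥ r)
    y≡ = begin
      y                                       ≡⟨ x⊕[y⊖x]≡y x y ⟨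
      x ⊕ᵥ (y ⊖ᵥ x)                           ≡⟨ cong₂ _⊕ᵥ_ x≡[1+i]p y⊖x≡2u ⟩
      mul1+iᵥ p ⊕ᵥ twiceᵥ u                   ≡⟨ cong (λ t → mul1+iᵥ p ⊕ᵥ twiceᵥ t) i·r≡u ⟨
      mul1+iᵥ p ⊕ᵥ twiceᵥ (mulIᵥ r)           ≡⟨ cong (mul1+iᵥ p ⊕ᵥ_) (mul1+iᵥ² r) ⟨
      mul1+iᵥ p ⊕ᵥ mul1+iᵥ (mul1+iᵥ r)        ≡⟨ mul1+iᵥ-⊕ᵥ p (mul1+iᵥ r) ⟨
      mul1+iᵥ (p ⊕ᵥ mul1+iᵥ r)                ∎

BW⇒InL : ∀ k {x} → BW k x → InL k x
BW⇒InL zero    _                       = tt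
BW⇒InL (suc k) (u , v , bu , bv , refl) =
  BW⇒InL k bu , subst (InM k) (sym ([x⊕y]⊖x≡y u (mul1+iᵥ v))) (InL⇒InM-mul1+i k (BW⇒InL k bv))

InL⇒BW : ∀ k {x} → InL k x → BW k x
InL⇒BW zero    _ = tt
InL⇒BW (suc k) {node x y} (l , m) with InM⇒mul1+i k m
... | v , lv , y⊖x≡[1+i]v =
  x , v , InL⇒BW k l , InL⇒BW k lv , cong (node x) (trans (sym (x⊕[y⊖x]≡y x y)) (cong (x ⊕ᵥ_) y⊖x≡[1+i]v))

-- The decomposition w = (u , u + (1+i) v) is unique.
BW-irrelevant : ∀ k → Irrelevant (BW k)
BW-irrelevant zero    _ _ = refl
BW-irrelevant (suc k) (u , v , bu , bv , refl) (u′ , v′ , bu′ , bv′ , eq)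
  with refl ← proj₁ (node-injective eq)
  with refl ← mul1+iᵥ-injective (trans (sym ([x⊕y]⊖x≡y u _)) (trans (cong (_⊖ᵥ u) (proj₂ (node-injective eq))) ([x⊕y]⊖x≡y u _)))
  with refl ← eq
  = cong₂ (λ b c → u , v , b , c , refl) (BW-irrelevant k bu bu′) (BW-irrelevant k bv bv′)

_≟ᵥ_ : DecidableEquality (CVec k)
leaf (a + b i) ≟ᵥ leaf (c + d i) = map′ (λ (p , q) → leaf≡ p q) leaf-injective (a ℤ.≟ c ×-dec b ℤ.≟ d)
node x y       ≟ᵥ node z w       = map′ (λ (p , q) → cong₂ node p q) node-injective (x ≟ᵥ z ×-dec y ≟ᵥ w)

mutual
  InL? : ∀ k (x : CVec k) → Dec (InL k x)
  InL? zero    _          = yes tt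
  InL? (suc k) (node x y) = InL? k x ×-dec InM? k (y ⊖ᵥ x)

  InM? : ∀ k (x : CVec k) → Dec (InM k x)
  InM? zero    (leaf (a + b i)) = + 2 ∣? a + b
  InM? (suc k) (node x y)       = InM? k x ×-dec In2L? k (y ⊖ᵥ x)

  In2L? : ∀ k (x : CVec k) → Dec (In2L k x)
  In2L? k x with twiceᵥ (halfᵥ x) ≟ᵥ x | InL? k (halfᵥ x)
  ... | yes 2h≡x | yes l  = yes (halfᵥ x , l , sym 2h≡x)
  ... | no  2h≢x | _      = no λ { (v , _ , refl) → 2h≢x (cong twiceᵥ (halfᵥ-twiceᵥ v)) }
  ... | yes _    | no  ¬l = no λ { (v , l , refl) → ¬l (subst (InL k) (sym (halfᵥ-twiceᵥ v)) l) }

BW? : ∀ k → Decidable (BW k)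
BW? k x = map′ (InL⇒BW k) (BW⇒InL k) (InL? k x)

-- Theta coefficients as box sums; the first congruence

BW-act : ∀ k (g : Symmetry k) {x} → BW k x → BW k (act g x)
BW-act k g b = InL⇒BW k (InL-act k g (BW⇒InL k b))

BW-zero : ∀ k → BW k (zeroᵥ k)
BW-zero k = InL⇒BW k (InL-zero k)

BW-norm? : ∀ k n → Decidable (λ u → BW k u × norm u ≡ n)
BW-norm? k n u = BW? k u ×-dec norm u ℕ.≟ n

𝟙-BW-norm-act : ∀ k n (g : Symmetry k) x → 𝟙 (BW-norm? k n (act g x)) ≡ 𝟙 (BW-norm? k n x)
𝟙-BW-norm-act k n g x = 𝟙-cong
  (λ (b , e) → subst (BW k) (act-involutive g x) (BW-act k g b) , trans (sym (norm-act g x)) e)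
  (λ (b , e) → BW-act k g b , trans (norm-act g x) e) (BW-norm? k n (act g x)) (BW-norm? k n x)

𝟙-BW-norm-zero : ∀ k n → 𝟙 (BW-norm? k n (zeroᵥ k)) ≡ one n
𝟙-BW-norm-zero k n = trans
  (𝟙-cong (λ (_ , e) → trans (sym (norm-zero k)) e) (λ e → BW-zero k , trans (norm-zero k) e) (BW-norm? k n (zeroᵥ k)) (0 ℕ.≟ n))
  (𝟙-0≟ n)
  where
  𝟙-0≟ : ∀ n → 𝟙 (0 ℕ.≟ n) ≡ one n
  𝟙-0≟ zero    = refl
  𝟙-0≟ (suc n) = refl

theta-as-∑ : ∀ k θ → IsThetaBW k θ → ∀ n R → n ≤ R → θ n ≡ ∑[ u ← box k R ] 𝟙 (BW-norm? k n u)
theta-as-∑ k θ θ-spec n R n≤R with θ-spec n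
... | c , θn≡c , enumeration = begin
  θ n                                       ≡⟨ θn≡c ⟩
  + c                                       ≡⟨ cong +_ (↔⇒≡ (↔-trans enumeration (↔-sym counted))) ⟩
  + length (filter (BW-norm? k n) (box k R)) ≡⟨ ∑-𝟙 (BW-norm? k n) (box k R) ⟨
  ∑[ u ← box k R ] 𝟙 (BW-norm? k n u)       ∎
  where
  counted : Fin (length (filter (BW-norm? k n) (box k R))) ↔ Σ (CVec k) (λ u → BW k u × norm u ≡ n)
  counted = Fin-count↔ (BW-norm? k n)
    (λ (b , e) (b′ , e′) → cong₂ _,_ (BW-irrelevant k b b′) (ℕₚ.≡-irrelevant e e′))
    (box-unique k R) (λ {u} (_ , e) → ∈-box k R u (subst (_≤ R) (sym e) n≤R))

box-radius-0 : ∀ k → box k 0 ≡ zeroᵥ k ∷ []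
box-radius-0 zero    = refl
box-radius-0 (suc k) rewrite box-radius-0 k = refl

theta-0 : ∀ k θ → IsThetaBW k θ → θ 0 ≡ 1ℤ
theta-0 k θ θ-spec = begin
  θ 0                                     ≡⟨ theta-as-∑ k θ θ-spec 0 0 z≤n ⟩
  ∑[ u ← box k 0 ] 𝟙 (BW-norm? k 0 u)     ≡⟨ cong (λ us → ∑[ u ← us ] 𝟙 (BW-norm? k 0 u)) (box-radius-0 k) ⟩
  𝟙 (BW-norm? k 0 (zeroᵥ k)) + 0ℤ         ≡⟨ cong (_+ 0ℤ) (𝟙-BW-norm-zero k 0) ⟩
  1ℤ                                      ∎

theta-≡1 : ∀ k θ → IsThetaBW k θ → ∀ n → pow2 (suc (suc k)) ∣ θ n - one n
theta-≡1 k θ θ-spec n =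
  subst₂ _∣_ (ℤₚ.*-identityʳ _) (cong₂ _-_ (sym (theta-as-∑ k θ θ-spec n n ℕₚ.≤-refl)) (𝟙-BW-norm-zero k n))
    (proj₂ (box-orbitDivisible k n) (λ u → 𝟙 (BW-norm? k n u)) 1ℤ (𝟙-BW-norm-act k n) (λ u → 1∣ (𝟙 (BW-norm? k n u))))

-- x ∈ BW k and y ≡ x modulo (1+i) BW k; equivalently node x y ∈ BW (suc k).
Congruent : ∀ k → CVec k → CVec k → Set
Congruent k x y = InL (suc k) (node x y)

Congruent? : ∀ k x y → Dec (Congruent k x y)
Congruent? k x y = InL? (suc k) (node x y)

Congruent-InLʳ : ∀ k {x y} → Congruent k x y → InL k y
Congruent-InLʳ k (l , m) = InL-shift k l m

Congruent-refl : ∀ k {x} → InL k x → Congruent k x x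
Congruent-refl k {x} l = l , subst (InM k) (sym (x⊖x≡0 x)) (InM-zero k)

Congruent-sym : ∀ k {x y} → Congruent k x y → Congruent k y x
Congruent-sym k {x} {y} c@(_ , m) = Congruent-InLʳ k c , subst (InM k) (sym (x⊖y≡-[y⊖x] x y)) (InM-neg k m)

Congruent-trans : ∀ k {x y z} → Congruent k x y → Congruent k y z → Congruent k x z
Congruent-trans k {x} {y} {z} (l , m) (_ , m′) = l , subst (InM k) ([x⊖y]⊕[y⊖z]≡x⊖z z y x) (InM-⊕ k m′ m)

𝟙-Congruent-sym : ∀ k x y → 𝟙 (Congruent? k x y) ≡ 𝟙 (Congruent? k y x)
𝟙-Congruent-sym k x y = 𝟙-cong (Congruent-sym k) (Congruent-sym k) (Congruent? k x y) (Congruent? k y x)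

𝟙-Congruent-zero : ∀ k y → 𝟙 (Congruent? k (zeroᵥ k) y) ≡ 𝟙 (InM? k y)
𝟙-Congruent-zero k y = 𝟙-cong (λ (_ , m) → subst (InM k) (x⊖0≡x y) m)
  (λ m → InL-zero k , subst (InM k) (sym (x⊖0≡x y)) m) (Congruent? k (zeroᵥ k) y) (InM? k y)

𝟙-Congruent-act : ∀ k (g : Symmetry k) x y → 𝟙 (Congruent? k (act g x) (act g y)) ≡ 𝟙 (Congruent? k x y)
𝟙-Congruent-act k g x y = 𝟙-cong
  (λ c → subst (InL (suc k)) (act-involutive (diag g) (node x y)) (InL-act (suc k) (diag g) c)) (InL-act (suc k) (diag g))
  (Congruent? k (act g x) (act g y)) (Congruent? k x y)

𝟙-Congruent-actˡ : ∀ k (g : Symmetry k) x y → 𝟙 (Congruent? k (act g x) y) ≡ 𝟙 (Congruent? k x y)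
𝟙-Congruent-actˡ k g x y = 𝟙-cong from to (Congruent? k (act g x) y) (Congruent? k x y)
  where
  to : Congruent k x y → Congruent k (act g x) y
  to (l , m) = InL-act k g l , subst (InM k) ([x⊖z]⊖[y⊖z]≡x⊖y y (act g x) x) (InM-⊖ k m (InM-act-⊖ k g l))
  from : Congruent k (act g x) y → Congruent k x y
  from (l′ , m′) = l , subst (InM k) ([x⊖y]⊕[y⊖z]≡x⊖z y (act g x) x) (InM-⊕ k m′ (InM-act-⊖ k g l))
    where l : InL k x
          l = subst (InL k) (act-involutive g x) (InL-act k g l′)

𝟙-Congruent-actʳ : ∀ k (g : Symmetry k) x y → 𝟙 (Congruent? k x (act g y)) ≡ 𝟙 (Congruent? k x y)
𝟙-Congruent-actʳ k g x y = begin
  𝟙 (Congruent? k x (act g y)) ≡⟨ 𝟙-Congruent-sym k x (act g y) ⟩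
  𝟙 (Congruent? k (act g y) x) ≡⟨ 𝟙-Congruent-actˡ k g y x ⟩
  𝟙 (Congruent? k y x)         ≡⟨ 𝟙-Congruent-sym k y x ⟩
  𝟙 (Congruent? k x y)         ∎

In[1+i]BW : ∀ k → CVec k → Set
In[1+i]BW k y = Σ (CVec k) λ v → BW k v × y ≡ mul1+iᵥ v

InM⇔In[1+i]BW : ∀ k {y} → (InM k y → In[1+i]BW k y) × (In[1+i]BW k y → InM k y)
InM⇔In[1+i]BW k = (λ m → let v , l , e = InM⇒mul1+i k m in v , InL⇒BW k l , e)
                 , (λ { (v , b , refl) → InL⇒InM-mul1+i k (BW⇒InL k b) })

In[1+i]BW-norm? : ∀ k n → Decidable (λ y → In[1+i]BW k y × norm y ≡ n)
In[1+i]BW-norm? k n y = map′ (proj₁ (InM⇔In[1+i]BW k)) (proj₂ (InM⇔In[1+i]BW k)) (InM? k y) ×-dec norm y ℕ.≟ n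

In[1+i]BW-norm-irrelevant : ∀ k n → Irrelevant (λ y → In[1+i]BW k y × norm y ≡ n)
In[1+i]BW-norm-irrelevant k n ((v , b , refl) , e) ((v′ , b′ , eq) , e′)
  with refl ← mul1+iᵥ-injective eq
  with refl ← eq
  = cong₂ (λ b e → (v , b , refl) , e) (BW-irrelevant k b b′) (ℕₚ.≡-irrelevant e e′)

norm-m↔norm-2m : ∀ k m → Σ (CVec k) (λ v → BW k v × norm v ≡ m) ↔ Σ (CVec k) (λ y → In[1+i]BW k y × norm y ≡ m ℕ.+ m)
norm-m↔norm-2m k m = mk↔ₛ′ to from to-from from-to
  where
  to : Σ (CVec k) (λ v → BW k v × norm v ≡ m) → Σ (CVec k) (λ y → In[1+i]BW k y × norm y ≡ m ℕ.+ m)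
  to (v , b , e) = mul1+iᵥ v , (v , b , refl) , trans (norm-mul1+iᵥ v) (cong₂ ℕ._+_ e e)
  half-norm : ∀ v → norm (mul1+iᵥ v) ≡ m ℕ.+ m → norm v ≡ m
  half-norm v e = trans (ℕₚ.n≡⌊n+n/2⌋ (norm v))
    (trans (cong ℕ.⌊_/2⌋ (trans (sym (norm-mul1+iᵥ v)) e)) (sym (ℕₚ.n≡⌊n+n/2⌋ m)))
  from : Σ (CVec k) (λ y → In[1+i]BW k y × norm y ≡ m ℕ.+ m) → Σ (CVec k) (λ v → BW k v × norm v ≡ m)
  from (_ , (v , b , refl) , e) = v , b , half-norm v e
  to-from : ∀ p → to (from p) ≡ p
  to-from (_ , (v , b , refl) , e) = cong (λ e → mul1+iᵥ v , (v , b , refl) , e) (ℕₚ.≡-irrelevant _ e)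
  from-to : ∀ p → from (to p) ≡ p
  from-to (v , b , e) = cong (λ e → v , b , e) (ℕₚ.≡-irrelevant _ e)

∑-InM-norm : ∀ k θ′ → IsThetaBW k θ′ → ∀ n → ∑[ y ← box k n ] 𝟙 (InM? k y ×-dec norm y ℕ.≟ n) ≡ sub2 θ′ n
∑-InM-norm k θ′ θ′-spec n with parity n
... | m , inj₂ refl = begin
  ∑[ y ← box k n ] 𝟙 (InM? k y ×-dec norm y ℕ.≟ n) ≡⟨ ∑-cong (box k n) no-odd-norm ⟩
  ∑[ y ← box k n ] 0ℤ                             ≡⟨ ∑-0 (box k n) ⟩
  0ℤ                                              ≡⟨ sub2-odd θ′ m ⟨
  sub2 θ′ n                                       ∎
  where
  no-odd-norm : ∀ y → 𝟙 (InM? k y ×-dec norm y ℕ.≟ n) ≡ 0ℤ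
  no-odd-norm y = 𝟙-cong impossible ⊥-elim (InM? k y ×-dec norm y ℕ.≟ n) (no λ ())
    where
    impossible : InM k y × norm y ≡ n → ⊥
    impossible (my , e) with InM⇒mul1+i k my
    ... | v , _ , refl = ℕₚ.even≢odd (norm v) m (begin
      2 ℕ.* norm v                ≡⟨ cong (norm v ℕ.+_) (ℕₚ.+-identityʳ (norm v)) ⟩
      norm v ℕ.+ norm v           ≡⟨ norm-mul1+iᵥ v ⟨
      norm (mul1+iᵥ v)            ≡⟨ e ⟩
      suc (m ℕ.+ m)               ≡⟨ cong (λ t → suc (m ℕ.+ t)) (ℕₚ.+-identityʳ m) ⟨
      suc (2 ℕ.* m)               ∎)
... | m , inj₁ refl with θ′-spec m
...   | c , θ′m≡c , enumeration = begin
  ∑[ y ← box k n ] 𝟙 (InM? k y ×-dec norm y ℕ.≟ n)            ≡⟨⟩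
  ∑[ y ← box k n ] 𝟙 (In[1+i]BW-norm? k n y)                  ≡⟨ ∑-𝟙 (In[1+i]BW-norm? k n) (box k n) ⟩
  + length (filter (In[1+i]BW-norm? k n) (box k n))
    ≡⟨ cong +_ (↔⇒≡ (↔-trans counted (↔-sym (↔-trans enumeration (norm-m↔norm-2m k m))))) ⟩
  + c                                                          ≡⟨ θ′m≡c ⟨
  θ′ m                                                         ≡⟨ sub2-even θ′ m ⟨
  sub2 θ′ n                                                    ∎
  where
  counted : Fin (length (filter (In[1+i]BW-norm? k n) (box k n))) ↔ Σ (CVec k) (λ y → In[1+i]BW k y × norm y ≡ n)
  counted = Fin-count↔ (In[1+i]BW-norm? k n) (In[1+i]BW-norm-irrelevant k n) (box-unique k n)
    (λ {y} (_ , e) → ∈-box k n y (ℕₚ.≤-reflexive e))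

-- The second congruence

2∣t[t-1] : ∀ t → + 2 ∣ t * (t - 1ℤ)
2∣t[t-1] t with t %ℕ 2 | n%ℕd<d t 2 | a≡a%ℕn+[a/ℕn]*n t 2
... | 0           | _            | t≡ =
  divides (t /ℕ 2 * (t - 1ℤ)) (trans (cong (_* (t - 1ℤ)) t≡) (lemma (t /ℕ 2) (t - 1ℤ)))
  where lemma : ∀ q u → (+ 0 + q * + 2) * u ≡ q * u * + 2
        lemma = solve-∀
... | 1           | _            | t≡ =
  divides (t * (t /ℕ 2)) (trans (cong (λ s → t * (s - 1ℤ)) t≡) (lemma t (t /ℕ 2)))
  where lemma : ∀ t q → t * ((+ 1 + q * + 2) - 1ℤ) ≡ t * q * + 2
        lemma = solve-∀
... | suc (suc _) | s≤s (s≤s ()) | _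

module SecondCongruence (k n′ : ℕ) where

  N : ℕ
  N = suc n′

  B : List (CVec k)
  B = box k N

  z : CVec k
  z = zeroᵥ k

  E : ℤ
  E = pow2 (suc (suc k))

  ∑′ : (CVec k → ℤ) → ℤ
  ∑′ F = ∑ B F - F z

  ∑′-cong : ∀ {F G : CVec k → ℤ} → (∀ x → F x ≡ G x) → ∑′ F ≡ ∑′ G
  ∑′-cong F≗G = cong₂ _-_ (∑-cong B F≗G) (F≗G z)

  ∑′-comm : ∀ (F : CVec k → CVec k → ℤ) → ∑′ (λ x → ∑′ (F x)) ≡ ∑′ (λ y → ∑′ (λ x → F x y))
  ∑′-comm F = begin
    ∑′ (λ x → ∑′ (F x))                                  ≡⟨ cong (_- ∑′ row) (∑-sub B (λ x → ∑ B (F x)) column) ⟩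
    (total - ∑ B column) - (∑ B row - F z z)             ≡⟨ swap total (∑ B column) (∑ B row) (F z z) ⟩
    (total - ∑ B row) - (∑ B column - F z z)             ≡⟨ cong (λ t → (t - ∑ B row) - (∑ B column - F z z)) (∑-comm B B F) ⟩
    (∑[ y ← B ] ∑ B (λ x → F x y) - ∑ B row) - ∑′ column ≡⟨ cong (_- ∑′ column) (∑-sub B (λ y → ∑ B (λ x → F x y)) row) ⟨
    ∑′ (λ y → ∑′ (λ x → F x y))                          ∎
    where
    row column : CVec k → ℤ
    row        = F z
    column x   = F x z
    total : ℤ
    total = ∑[ x ← B ] ∑ B (F x)
    swap : ∀ a b c d → (a - b) - (c - d) ≡ (a - c) - (b - d)
    swap = solve-∀

  ∑′-∑antidiag : ∀ (F : ℕ → ℕ → CVec k → ℤ) n →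
                 ∑′ (λ x → ∑antidiag (λ a b → F a b x) n) ≡ ∑antidiag (λ a b → ∑′ (F a b)) n
  ∑′-∑antidiag F n = trans (cong (_- ∑antidiag (λ a b → F a b z) n) (∑-∑antidiag B F n)) (∑antidiag-sub _ _ n)

  [_∼_] : CVec k → CVec k → ℤ
  [ x ∼ y ] = 𝟙 (Congruent? k x y)

  H : CVec k → CVec k → ℤ
  H x y = [ x ∼ y ] * 𝟙 (norm x ℕ.+ norm y ℕ.≟ N)

  K : ℕ → ℕ → CVec k → CVec k → ℤ
  K a b x y = [ x ∼ y ] * (𝟙 (norm x ℕ.≟ a) * 𝟙 (norm y ℕ.≟ b))

  q : ℕ → ℕ → ℤ
  q a b = ∑′ (λ x → ∑′ (K a b x))

  -- P counts the (x , y) ∈ BW (suc k) of norm N with x ≠ 0 and y ≠ 0.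
  P : ℤ
  P = ∑′ (λ x → ∑′ (H x))

  P≡∑antidiag-q : P ≡ ∑antidiag q N
  P≡∑antidiag-q = begin
    ∑′ (λ x → ∑′ (H x))                                             ≡⟨ ∑′-cong (λ x → ∑′-cong (H-split x)) ⟩
    ∑′ (λ x → ∑′ (λ y → ∑antidiag (λ a b → K a b x y) N))           ≡⟨ ∑′-cong (λ x → ∑′-∑antidiag (λ a b y → K a b x y) N) ⟩
    ∑′ (λ x → ∑antidiag (λ a b → ∑′ (K a b x)) N)                   ≡⟨ ∑′-∑antidiag (λ a b x → ∑′ (K a b x)) N ⟩
    ∑antidiag q N                                                   ∎
    where
    H-split : ∀ x y → H x y ≡ ∑antidiag (λ a b → K a b x y) N
    H-split x y = trans (cong ([ x ∼ y ] *_) (𝟙-+≟ (norm x) (norm y) N))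
                        (∑antidiag-*ˡ [ x ∼ y ] (λ a b → 𝟙 (norm x ℕ.≟ a) * 𝟙 (norm y ℕ.≟ b)) N)

  q-sym : ∀ a b → q a b ≡ q b a
  q-sym a b = trans (∑′-comm (K a b)) (∑′-cong (λ y → ∑′-cong (λ x →
    cong₂ _*_ (𝟙-Congruent-sym k x y) (ℤₚ.*-comm (𝟙 (norm x ℕ.≟ a)) (𝟙 (norm y ℕ.≟ b))))))

  E∣∑′ : ∀ (F : CVec k → ℤ) → (∀ g x → F (act g x) ≡ F x) → ∀ {d} → (∀ x → d ∣ F x) → E * d ∣ ∑′ F
  E∣∑′ F F-inv d∣F = proj₂ (box-orbitDivisible k N) F _ F-inv d∣F

  E∣∑′-𝟙 : ∀ (F : CVec k → ℤ) → (∀ g x → F (act g x) ≡ F x) → (∀ x → 1ℤ ∣ F x) → E ∣ ∑′ F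
  E∣∑′-𝟙 F F-inv 1∣F = subst (_∣ ∑′ F) (ℤₚ.*-identityʳ E) (E∣∑′ F F-inv 1∣F)

  E²∣q : ∀ a b → E * E ∣ q a b
  E²∣q a b = E∣∑′ (λ x → ∑′ (K a b x)) outer-inv (λ x → E∣∑′-𝟙 (K a b x) (inner-inv x) (λ y → 1∣ (K a b x y)))
    where
    K-act : ∀ g x y → K a b (act g x) (act g y) ≡ K a b x y
    K-act g x y = cong₂ _*_ (𝟙-Congruent-act k g x y)
                            (cong₂ _*_ (cong (λ t → 𝟙 (t ℕ.≟ a)) (norm-act g x)) (cong (λ t → 𝟙 (t ℕ.≟ b)) (norm-act g y)))
    inner-inv : ∀ x g y → K a b x (act g y) ≡ K a b x y
    inner-inv x g y = cong₂ _*_ (𝟙-Congruent-actʳ k g x y) (cong (λ t → 𝟙 (norm x ℕ.≟ a) * 𝟙 (t ℕ.≟ b)) (norm-act g y))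
    outer-inv : ∀ g x → ∑′ (K a b (act g x)) ≡ ∑′ (K a b x)
    outer-inv g x = cong₂ _-_ (trans (sym (∑-box-act k N g (K a b (act g x)))) (∑-cong B (K-act g x)))
                              (trans (cong (K a b (act g x)) (sym (act-zero g))) (K-act g x z))

  P≡middle : + 2 * (E * E) ∣ P - middle q N
  P≡middle = subst (λ t → + 2 * (E * E) ∣ t - middle q N) (sym P≡∑antidiag-q) (∑antidiag-symmetric N q (E * E) q-sym E²∣q)

  module Middle (m′ : ℕ) where

    m : ℕ
    m = suc m′

    ν : CVec k → ℤ
    ν x = 𝟙 (norm x ℕ.≟ m)

    ν-z : ν z ≡ 0ℤ
    ν-z rewrite norm-zero k = refl

    A : CVec k → ℤ
    A y = ∑[ x ← B ] ([ x ∼ y ] * ν x)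

    E∣A : ∀ y → E ∣ A y
    E∣A y = subst (E ∣_) (trans (cong (_-_ (A y)) z-term) (ℤₚ.+-identityʳ (A y)))
                  (E∣∑′-𝟙 (λ x → [ x ∼ y ] * ν x) inv (λ x → 1∣ _))
      where
      z-term : [ z ∼ y ] * ν z ≡ 0ℤ
      z-term = trans (cong ([ z ∼ y ] *_) ν-z) (ℤₚ.*-zeroʳ [ z ∼ y ])
      inv : ∀ g x → [ act g x ∼ y ] * ν (act g x) ≡ [ x ∼ y ] * ν x
      inv g x = cong₂ _*_ (𝟙-Congruent-actˡ k g x y) (cong (λ t → 𝟙 (t ℕ.≟ m)) (norm-act g x))

    A-resp : ∀ {r y} → Congruent k r y → A y ≡ A r
    A-resp {r} {y} r∼y = ∑-cong B (λ x → cong (_* ν x)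
      (𝟙-cong (λ x∼y → Congruent-trans k x∼y (Congruent-sym k r∼y)) (λ x∼r → Congruent-trans k x∼r r∼y)
              (Congruent? k x y) (Congruent? k x r)))

    A-outside : ∀ {y} → ¬ BW k y → A y ≡ 0ℤ
    A-outside {y} ¬b = trans (∑-cong B (λ x → trans (cong (_* ν x)
      (𝟙-cong (λ c → ¬b (InL⇒BW k (Congruent-InLʳ k c))) ⊥-elim (Congruent? k x y) (no λ ()))) (ℤₚ.*-zeroˡ (ν x)))) (∑-0 B)

    β : CVec k → ℤ
    β y = 𝟙 (BW-norm? k m y)

    ∑′K : ∀ y → ∑′ (λ x → K m m x y) ≡ ν y * A y
    ∑′K y = begin
      ∑[ x ← B ] K m m x y - K m m z y                               ≡⟨ cong₂ _-_ (∑-cong B (λ x → reorder [ x ∼ y ] (ν x) (ν y))) z-term ⟩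
      ∑[ x ← B ] (ν y * ([ x ∼ y ] * ν x)) - 0ℤ
                                                                     ≡⟨ ℤₚ.+-identityʳ _ ⟩
      ∑[ x ← B ] (ν y * ([ x ∼ y ] * ν x))
                                                                     ≡⟨ ∑-*ˡ B (ν y) _ ⟩
      ν y * A y                                         ∎
      where
      reorder : ∀ c a b → c * (a * b) ≡ b * (c * a)
      reorder = solve-∀
      z-term : K m m z y ≡ 0ℤ
      z-term = trans (cong (λ t → [ z ∼ y ] * (t * ν y)) ν-z) (lemma [ z ∼ y ] (ν y))
        where lemma : ∀ c b → c * (0ℤ * b) ≡ 0ℤ
              lemma = solve-∀

    q-middle : q m m ≡ ∑[ y ← B ] (β y * A y)
    q-middle = begin
      q m m                                         ≡⟨ ∑′-comm (K m m) ⟩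
      ∑′ (λ y → ∑′ (λ x → K m m x y))               ≡⟨ ∑′-cong ∑′K ⟩
      ∑′ (λ y → ν y * A y)             ≡⟨ cong (_-_ (∑[ y ← B ] (ν y * A y))) (trans (cong (_* A z) ν-z) (ℤₚ.*-zeroˡ (A z))) ⟩
      ∑[ y ← B ] (ν y * A y) - 0ℤ      ≡⟨ ℤₚ.+-identityʳ _ ⟩
      ∑[ y ← B ] (ν y * A y)           ≡⟨ ∑-cong B (λ y → trans (on-BW y (BW? k y)) (cong (_* A y) (sym (𝟙-× (BW? k y) (norm y ℕ.≟ m))))) ⟩
      ∑[ y ← B ] (β y * A y)                        ∎
      where
      on-BW : ∀ y (b? : Dec (BW k y)) → ν y * A y ≡ 𝟙 b? * ν y * A y
      on-BW y (yes _) = cong (_* A y) (sym (ℤₚ.*-identityˡ (ν y)))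
      on-BW y (no ¬b) rewrite A-outside ¬b = trans (ℤₚ.*-zeroʳ (ν y)) (sym (ℤₚ.*-zeroʳ (0ℤ * ν y)))

    open ClassRepresentatives (Congruent? k) (Congruent-sym k) (Congruent-trans k) _≟ᵥ_ B (box-unique k N)

    Φ : CVec k → ℤ
    Φ y = β y * (A y - E)

    Φ-support : ∀ y → ¬ Congruent k y y → Φ y ≡ 0ℤ
    Φ-support y ¬c = trans (cong (_* (A y - E)) β≡0) (ℤₚ.*-zeroˡ (A y - E))
      where β≡0 : β y ≡ 0ℤ
            β≡0 = 𝟙-cong (λ (b , _) → ¬c (Congruent-refl k (BW⇒InL k b))) ⊥-elim (BW-norm? k m y) (no λ ())

    class-sum : ∀ r → ∑[ y ← B ] ([ r ∼ y ] * Φ y) ≡ A r * (A r - E)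
    class-sum r = begin
      ∑[ y ← B ] ([ r ∼ y ] * Φ y)                 ≡⟨ ∑-cong B constant-on-class ⟩
      ∑[ y ← B ] ([ r ∼ y ] * β y * (A r - E))     ≡⟨ ∑-*ʳ B _ (A r - E) ⟩
      ∑[ y ← B ] ([ r ∼ y ] * β y) * (A r - E)     ≡⟨ cong (_* (A r - E)) (∑-cong B counted) ⟩
      A r * (A r - E)                                         ∎
      where
      constant-on-class : ∀ y → [ r ∼ y ] * Φ y ≡ [ r ∼ y ] * β y * (A r - E)
      constant-on-class y = on-class (Congruent? k r y)
        where
        on-class : (c? : Dec (Congruent k r y)) → 𝟙 c? * Φ y ≡ 𝟙 c? * β y * (A r - E)
        on-class (yes r∼y) = trans (cong (λ t → 1ℤ * (β y * (t - E))) (A-resp r∼y)) (sym (ℤₚ.*-assoc 1ℤ (β y) (A r - E)))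
        on-class (no _)    = trans (ℤₚ.*-zeroˡ (Φ y)) (sym (trans (cong (_* (A r - E)) (ℤₚ.*-zeroˡ (β y))) (ℤₚ.*-zeroˡ (A r - E))))
      counted : ∀ y → [ r ∼ y ] * β y ≡ [ y ∼ r ] * ν y
      counted y = begin
        [ r ∼ y ] * β y                                       ≡⟨ cong ([ r ∼ y ] *_) (𝟙-× (BW? k y) (norm y ℕ.≟ m)) ⟩
        [ r ∼ y ] * (𝟙 (BW? k y) * ν y)          ≡⟨ ℤₚ.*-assoc [ r ∼ y ] (𝟙 (BW? k y)) (ν y) ⟨
        [ r ∼ y ] * 𝟙 (BW? k y) * ν y            ≡⟨ cong (_* ν y) (𝟙-× (Congruent? k r y) (BW? k y)) ⟨
        𝟙 (Congruent? k r y ×-dec BW? k y) * ν y            ≡⟨ cong (_* ν y) (𝟙-cong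
                                                                             (λ (r∼y , _) → Congruent-sym k r∼y)
                                                                             (λ y∼r → Congruent-sym k y∼r , InL⇒BW k (proj₁ y∼r))
                                                                             (Congruent? k r y ×-dec BW? k y) (Congruent? k y r)) ⟩
        [ y ∼ r ] * ν y                          ∎

    2E²∣a[a-E] : ∀ {a} → E ∣ a → + 2 * (E * E) ∣ a * (a - E)
    2E²∣a[a-E] (divides t refl) = subst (_ ∣_) (sym (lemma t E)) (*-pres-∣ (2∣t[t-1] t) (∣-refl {E * E}))
      where lemma : ∀ t e → t * e * (t * e - e) ≡ t * (t - 1ℤ) * (e * e)
            lemma = solve-∀

    middle-congruence : + 2 * (E * E) ∣ q m m - E * ∑ B β
    middle-congruence = subst (_ ∣_) (sym q-E∑β) (∑-∣ B (λ r → ∣n⇒∣m*n (𝟙 (rep r ≟ᵥ r)) (2E²∣a[a-E] (E∣A r))))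
      where
      factor : ∀ b a e → b * a - e * b ≡ b * (a - e)
      factor = solve-∀
      q-E∑β : q m m - E * ∑ B β ≡ ∑[ r ← B ] (𝟙 (rep r ≟ᵥ r) * (A r * (A r - E)))
      q-E∑β = begin
        q m m - E * ∑ B β                                      ≡⟨ cong₂ _-_ q-middle (sym (∑-*ˡ B E β)) ⟩
        ∑[ y ← B ] (β y * A y) - ∑[ y ← B ] (E * β y)          ≡⟨ ∑-sub B _ _ ⟨
        ∑[ y ← B ] (β y * A y - E * β y)                       ≡⟨ ∑-cong B (λ y → factor (β y) (A y) E) ⟩
        ∑ B Φ                                                  ≡⟨ ∑-by-classes Φ Φ-support ⟩
        ∑[ r ← B ] (𝟙 (rep r ≟ᵥ r) * ∑[ y ← B ] ([ r ∼ y ] * Φ y))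
                                                               ≡⟨ ∑-cong B (λ r → cong (𝟙 (rep r ≟ᵥ r) *_) (class-sum r)) ⟩
        ∑[ r ← B ] (𝟙 (rep r ≟ᵥ r) * (A r * (A r - E)))        ∎

  H-sym : ∀ x y → H x y ≡ H y x
  H-sym x y = cong₂ _*_ (𝟙-Congruent-sym k x y) (cong (λ t → 𝟙 (t ℕ.≟ N)) (ℕₚ.+-comm (norm x) (norm y)))

  θ-1≡P+2[θ′x²-1] : ∀ θ θ′ → IsThetaBW (suc k) θ → IsThetaBW k θ′ → θ N - one N ≡ P + + 2 * (sub2 θ′ N - one N)
  θ-1≡P+2[θ′x²-1] θ θ′ θ-spec θ′-spec = begin
    θ N - one N                                                    ≡⟨ cong₂ _-_ θN≡∑∑H (sym Hzz≡1N) ⟩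
    S - H z z                                                      ≡⟨ lemma S (∑ B (H z)) (H z z) ⟩
    ((S - ∑ B (H z)) - (∑ B (H z) - H z z)) + + 2 * (∑ B (H z) - H z z)
                                                                   ≡⟨ cong (λ t → ((S - t) - (∑ B (H z) - H z z)) + + 2 * (∑ B (H z) - H z z))
                                                                           (∑-cong B (λ x → H-sym z x)) ⟩
    ((S - ∑[ x ← B ] H x z) - (∑ B (H z) - H z z)) + + 2 * (∑ B (H z) - H z z)
                                                                   ≡⟨ cong₂ (λ s t → (s - (∑ B (H z) - H z z)) + + 2 * t)
                                                                            (sym (∑-sub B (λ x → ∑ B (H x)) (λ x → H x z)))
                                                                            (cong₂ _-_ ∑H0y≡θ′x² Hzz≡1N) ⟩
    P + + 2 * (sub2 θ′ N - one N)                                  ∎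
    where
    S : ℤ
    S = ∑[ x ← B ] ∑[ y ← B ] H x y
    lemma : ∀ s y h → s - h ≡ ((s - y) - (y - h)) + + 2 * (y - h)
    lemma = solve-∀

    θN≡∑∑H : θ N ≡ S
    θN≡∑∑H = trans (theta-as-∑ (suc k) θ θ-spec N N ℕₚ.≤-refl) (trans (∑-box-suc k N _)
      (∑-cong B (λ x → ∑-cong B (λ y → 𝟙-× (BW? (suc k) (node x y)) (norm x ℕ.+ norm y ℕ.≟ N)))))

    Hzz≡1N : H z z ≡ one N
    Hzz≡1N rewrite norm-zero k = ℤₚ.*-zeroʳ [ z ∼ z ]

    ∑H0y≡θ′x² : ∑[ y ← B ] H z y ≡ sub2 θ′ N
    ∑H0y≡θ′x² = trans (∑-cong B (λ y → trans
        (cong₂ _*_ (𝟙-Congruent-zero k y) (cong (λ t → 𝟙 (t ℕ.+ norm y ℕ.≟ N)) (norm-zero k)))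
        (sym (𝟙-× (InM? k y) (norm y ℕ.≟ N)))))
      (∑-InM-norm k θ′ θ′-spec N)

  P≡E[θ′x²-1] : ∀ θ′ → IsThetaBW k θ′ → + 2 * (E * E) ∣ P - E * (sub2 θ′ N - one N)
  P≡E[θ′x²-1] θ′ θ′-spec with parity N
  ... | zero   , inj₁ ()
  ... | suc m′ , inj₁ N≡m+m = subst (_ ∣_) split (∣m∣n⇒∣m+n P≡middle middle-congruence)
    where
    open Middle m′
    θ′x²-1≡∑β : sub2 θ′ N - one N ≡ ∑ B β
    θ′x²-1≡∑β = begin
      sub2 θ′ N - 0ℤ    ≡⟨ ℤₚ.+-identityʳ _ ⟩
      sub2 θ′ N         ≡⟨ trans (cong (sub2 θ′) N≡m+m) (sub2-even θ′ m) ⟩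
      θ′ m              ≡⟨ theta-as-∑ k θ′ θ′-spec m N (subst (m ≤_) (sym N≡m+m) (ℕₚ.m≤m+n m m)) ⟩
      ∑ B β             ∎
    lemma : ∀ p d e → (p - d) + (d - e) ≡ p - e
    lemma = solve-∀
    split : (P - middle q N) + (q m m - E * ∑ B β) ≡ P - E * (sub2 θ′ N - one N)
    split = begin
      (P - middle q N) + (q m m - E * ∑ B β) ≡⟨ cong (λ t → (P - t) + (q m m - E * ∑ B β)) (trans (cong (middle q) N≡m+m) (middle-even q m)) ⟩
      (P - q m m) + (q m m - E * ∑ B β)     ≡⟨ lemma P (q m m) (E * ∑ B β) ⟩
      P - E * ∑ B β                         ≡⟨ cong (λ t → P - E * t) θ′x²-1≡∑β ⟨
      P - E * (sub2 θ′ N - one N)           ∎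
  ... | m      , inj₂ N≡odd = subst (_ ∣_) split P≡middle
    where
    split : P - middle q N ≡ P - E * (sub2 θ′ N - one N)
    split = begin
      P - middle q N                 ≡⟨ cong (_-_ P) (trans (cong (middle q) N≡odd) (middle-odd q m)) ⟩
      P - 0ℤ                         ≡⟨ cong (_-_ P) (ℤₚ.*-zeroʳ E) ⟨
      P - E * 0ℤ                     ≡⟨ cong (λ t → P - E * t) (trans (cong (λ t → sub2 θ′ t - 0ℤ) N≡odd) (cong (_- 0ℤ) (sub2-odd θ′ m))) ⟨
      P - E * (sub2 θ′ N - one N)    ∎

second-congruence : ∀ k (θ θ′ : PowerSeries) → IsThetaBW (suc k) θ → IsThetaBW k θ′ → ∀ n →
  + 2 * (pow2 (suc (suc k)) * pow2 (suc (suc k))) ∣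
    (θ n - one n) - + 2 * (sub2 θ′ n - one n) - pow2 (suc (suc k)) * (sub2 θ′ n - one n)
second-congruence k θ θ′ θ-spec θ′-spec zero rewrite theta-0 (suc k) θ θ-spec | theta-0 k θ′ θ′-spec =
  subst (+ 2 * (pow2 (suc (suc k)) * pow2 (suc (suc k))) ∣_) (sym (lemma (pow2 (suc (suc k))))) (∣0 _)
  where lemma : ∀ e → (1ℤ - 1ℤ) - + 2 * (1ℤ - 1ℤ) - e * (1ℤ - 1ℤ) ≡ 0ℤ
        lemma = solve-∀
second-congruence k θ θ′ θ-spec θ′-spec (suc n′) =
  subst (_ ∣_) (sym (trans (cong (λ t → t - + 2 * c - E * c) (θ-1≡P+2[θ′x²-1] θ θ′ θ-spec θ′-spec)) (lemma P c E)))
        (P≡E[θ′x²-1] θ′ θ′-spec)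
  where
  open SecondCongruence k n′
  c : ℤ
  c = sub2 θ′ N - one N
  lemma : ∀ p c e → (p + + 2 * c) - + 2 * c - e * c ≡ p - e * c
  lemma = solve-∀

quotient-congruence : ∀ k (θ θ′ a b : PowerSeries) → IsThetaBW (suc k) θ → IsThetaBW k θ′ →
  (∀ n → θ n - one n ≡ + (2 ^ suc (suc (suc k))) * a n) →
  (∀ n → sub2 θ′ n - one n ≡ + (2 ^ suc (suc k)) * b n) →
  a ≡ (λ n → (+ 1 - + (2 ^ suc k)) * b n) [mod 2 ^ suc (suc k) ]
quotient-congruence k θ θ′ a b θ-spec θ′-spec θ-1≡Ta θ′-1≡Eb n =
  ∣⇒∣ᵤ (*-cancelˡ-∣ T {{ℕₚ.m^n≢0 2 (suc (suc (suc k)))}}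
         (subst (_∣ T * (a n - (1ℤ - p) * b n)) 2E²≡TE T*diff))
  where
  p E T : ℤ
  p = pow2 (suc k)
  E = pow2 (suc (suc k))
  T = pow2 (suc (suc (suc k)))

  expand : ∀ p e t a b θ₁ c → e ≡ + 2 * p → t ≡ + 2 * e → θ₁ ≡ t * a → c ≡ e * b →
           t * (a - (1ℤ - p) * b) ≡ (θ₁ - + 2 * c - e * c) + + 2 * (e * e) * b
  expand p _ _ a b _ _ refl refl refl refl = lemma p a b
    where lemma : ∀ p a b → + 2 * (+ 2 * p) * (a - (1ℤ - p) * b) ≡
                  (+ 2 * (+ 2 * p) * a - + 2 * (+ 2 * p * b) - + 2 * p * (+ 2 * p * b)) + + 2 * (+ 2 * p * (+ 2 * p)) * b
          lemma = solve-∀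

  T*diff : + 2 * (E * E) ∣ T * (a n - (1ℤ - p) * b n)
  T*diff = subst (_ ∣_)
    (sym (expand p E T (a n) (b n) (θ n - one n) (sub2 θ′ n - one n)
                 (pow2-suc (suc k)) (pow2-suc (suc (suc k))) (θ-1≡Ta n) (θ′-1≡Eb n)))
    (∣m∣n⇒∣m+n (second-congruence k θ θ′ θ-spec θ′-spec n) (∣m⇒∣m*n (b n) ∣-refl))

  2E²≡TE : + 2 * (E * E) ≡ T * E
  2E²≡TE = sym (trans (cong (_* E) (pow2-suc (suc (suc k)))) (ℤₚ.*-assoc (+ 2) E E))

theorem16 :
    (∀ (k : ℕ) (θ : PowerSeries) → IsThetaBW k θ →
       (θ ≡ one [mod 2 ^ suc (suc k) ]) × InP (2 ^ suc k) θ)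
    ×
    (∀ (k : ℕ) (θ θ′ a b : PowerSeries) →
       IsThetaBW (suc k) θ → IsThetaBW k θ′ →
       (∀ n → θ n - one n ≡ + (2 ^ suc (suc (suc k))) * a n) →
       (∀ n → sub2 θ′ n - one n ≡ + (2 ^ suc (suc k)) * b n) →
       a ≡ (λ n → (+ 1 - + (2 ^ suc k)) * b n) [mod 2 ^ suc (suc k) ])
theorem16 = part₁ , quotient-congruence
  where
  part₁ : ∀ k θ → IsThetaBW k θ → (θ ≡ one [mod 2 ^ suc (suc k) ]) × InP (2 ^ suc k) θ
  part₁ k θ θ-spec = (λ n → ∣⇒∣ᵤ (theta-≡1 k θ θ-spec n))
                   , 2^j-th-root (suc k) θ (theta-0 k θ θ-spec) (theta-≡1 k θ θ-spec)
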